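{- (1) Let $R$ be a net simulation. If $t\,R\,t'$ and there is a multi type derivation of $\Gamma\vdash t : M$, then there is a derivation of $\Gamma\vdash t' : M$. (2) If $t\precsim_{net} t'$ then $t\precsim_{type} t'$.
   Context: VSC terms $t ::= v\mid tu\mid t[x\leftarrow u]$, values $v::=x\mid\lambda x.t$ ($[x\leftarrow u]$ binds $x$). Substitution contexts $L::=\langle\cdot\rangle\mid L[x\leftarrow t]$, evaluation contexts $E::=\langle\cdot\rangle\mid tE\mid Et\mid E[x\leftarrow u]\mid t[x\leftarrow E]$; $\to_{vsc}$ is the closure under $E$ of $L\langle\lambda x.t\rangle u\mapsto L\langle t[x\leftarrow u]\rangle$ and $t[x\leftarrow L\langle v\rangle]\mapsto L\langle t\{x:=v\}\rangle$ (capture-avoiding). Normal forms modulo commutation: $\mathbb{i}::=xf\mid\mathbb{i}f$; $i::=\mathbb{i}\mid i[x\leftarrow i']$; $f,n::=v\mid i\mid f[x\leftarrow i]$; $I::=\langle\cdot\rangle\mid I[x\leftarrow i]$. Big step $t\Downarrow_k f$: $v\Downarrow_0v$; $t\Downarrow_kI\langle\lambda x.s\rangle$, $s[x\leftarrow u]\Downarrow_if\Rightarrow tu\Downarrow_{k+i+1}I\langle f\rangle$; $t\Downarrow_kI\langle x\rangle$, $u\Downarrow_hf\Rightarrow tu\Downarrow_{k+h}I\langle xf\rangle$; $t\Downarrow_kI\langle\mathbb{i}\rangle$, $u\Downarrow_hf\Rightarrow tu\Downarrow_{k+h}I\langle\mathbb{i}f\rangle$; $u\Downarrow_kI\langle v\rangle$,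 $t\{x:=v\}\Downarrow_if\Rightarrow t[x\leftarrow u]\Downarrow_{k+i+1}I\langle f\rangle$; $t\Downarrow_kf$, $u\Downarrow_hi\Rightarrow t[x\leftarrow u]\Downarrow_{k+h}f[x\leftarrow i]$. $t\Downarrow n$ means $\exists k$, $t\Downarrow_kn$. Structural equivalence $\equiv_{str}$: smallest equivalence closed under all contexts ($C::=\langle\cdot\rangle\mid tC\mid Ct\mid\lambda x.C\mid C[x\leftarrow t]\mid t[x\leftarrow C]$) containing $(ts)[x\leftarrow u]\equiv t[x\leftarrow u]s$ ($x\notin fv(s)$), $(ts)[x\leftarrow u]\equiv t(s[x\leftarrow u])$ ($x\notin fv(t)$), $t[x\leftarrow u][y\leftarrow s]\equiv t[x\leftarrow u[y\leftarrow s]]$ ($y\notin fv(t)$), $t[y\leftarrow s][x\leftarrow u]\equiv t[x\leftarrow u][y\leftarrow s]$ ($x\notin fv(s)$, $y\notin fv(u)$). Net simulation: a relation $R$ such that whenever $tRt'$ one of: $t$ has no $\to_{vsc}$-normal form; $t\Downarrow x$ and $t'\Downarrow x$; $t\Downarrow\lambda x.t_1$, $t'\Downarrow\lambda x.t_1'$, $t_1Rt_1'$; $t\Downarrow n_1n_2$, $t'\Downarrow n'\equiv_{str}n_1'n_2'$, $n_1Rn_1'$, $n_2Rn_2'$; $t\Downarrow n_1[x\leftarrow n_2]$, $t'\Downarrow n'\equiv_{str}n_1'[x\leftarrow n_2']$, $n_1Rn_1'$, $n_2Rn_2'$. Net similarity $\precsim_{net}$ is the largest net simulation. Multi types: linear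 types $L::=M\multimap N$; multi types $M,N::=[L_1,\dots,L_n]$ ($n\ge0$, finite multisets; $\uplus$ multiset union). Typing contexts assign multi types to finitely many variables (others get $[\,]$), $\uplus$ extended pointwise. Rules: $x:[L]\vdash x:L$; from $\Gamma,x:M\vdash t:N$ infer $\Gamma\vdash\lambda x.t:M\multimap N$; from $(\Gamma_i\vdash v:L_i)_{i\in I}$, $I$ finite, infer $\uplus_i\Gamma_i\vdash v:\uplus_i[L_i]$; from $\Gamma\vdash t:[M\multimap N]$ and $\Delta\vdash u:M$ infer $\Gamma\uplus\Delta\vdash tu:N$; from $\Gamma,x:M\vdash t:N$ and $\Delta\vdash u:M$ infer $\Gamma\uplus\Delta\vdash t[x\leftarrow u]:N$. Type preorder: $t\precsim_{type}t'$ iff for all $\Gamma$ and multi types $M$, if $\Gamma\vdash t:M$ is derivable then $\Gamma\vdash t':M$ is derivable. -}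

module Defs where

-- Value Substitution Calculus (VSC) with locally nameless-free de Bruijn
-- indices: a binder [x <- u] / lambda x binds index 0 of its body.

open import Data.Nat using (ℕ; zero; suc; _+_; _≡ᵇ_)
open import Data.Bool using (if_then_else_)
open import Data.List using (List; []; _∷_; _++_; length)
open import Data.List.Relation.Unary.All using (All)
open import Data.Product using (Σ; ∃; _×_; _,_)
open import Data.Sum using (_⊎_)
open import Relation.Nullary using (¬_)
open import Relation.Binary.Construct.Closure.ReflexiveTransitive using (Star)

data Term : Set where
  var : ℕ → Term
  lam : Term → Term
  app : Term → Term → Term
  es  : Term → Term → Term     -- t[x ← u]  (x = index 0 in t, not bound in u)

data IsValue : Term → Set where
  var : ∀ x → IsValue (var x)
  lam : ∀ t → IsValue (lam t)

liftRen : (ℕ → ℕ) → ℕ → ℕ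
liftRen ρ zero    = zero
liftRen ρ (suc n) = suc (ρ n)

rename : (ℕ → ℕ) → Term → Term
rename ρ (var x)   = var (ρ x)
rename ρ (lam t)   = lam (rename (liftRen ρ) t)
rename ρ (app t u) = app (rename ρ t) (rename ρ u)
rename ρ (es t u)  = es (rename (liftRen ρ) t) (rename ρ u)

liftSub : (ℕ → Term) → ℕ → Term
liftSub σ zero    = var zero
liftSub σ (suc n) = rename suc (σ n)

subst : (ℕ → Term) → Term → Term
subst σ (var x)   = σ x
subst σ (lam t)   = lam (subst (liftSub σ) t)
subst σ (app t u) = app (subst σ t) (subst σ u)
subst σ (es t u)  = es (subst (liftSub σ) t) (subst σ u)

shift : ℕ → Term → Term
shift k = rename (k +_)

-- t{x:=v} where t lives under binder x (index 0) and the result is placed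
-- under k further binders (those of a substitution context L):
-- index 0 ↦ v, index (suc n) ↦ n + k
substUnder : ℕ → Term → Term → Term
substUnder k v t = subst σ t
  where
  σ : ℕ → Term
  σ zero    = v
  σ (suc n) = var (k + n)

-- Substitution contexts  L ::= ⟨·⟩ | L[x ← t]
-- represented as lists, head = outermost substitution:
-- plug (u ∷ L) t = (L⟨t⟩)[x ← u]

SCtx : Set
SCtx = List Term

plug : SCtx → Term → Term
plug []      t = t
plug (u ∷ L) t = es (plug L t) u

data _⟶_ : Term → Term → Set where
  rootM : ∀ L t u → app (plug L (lam t)) u ⟶ plug L (es t (shift (length L) u))
  rootE : ∀ L t v → IsValue v →
          es t (plug L v) ⟶ plug L (substUnder (length L) v t)
  appL  : ∀ {t t'} u → t ⟶ t' → app t u ⟶ app t' u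
  appR  : ∀ t {u u'} → u ⟶ u' → app t u ⟶ app t u'
  esL   : ∀ {t t'} u → t ⟶ t' → es t u ⟶ es t' u
  esR   : ∀ t {u u'} → u ⟶ u' → es t u ⟶ es t u'

_⟶*_ : Term → Term → Set
_⟶*_ = Star _⟶_

Normal : Term → Set
Normal n = ∀ s → ¬ (n ⟶ s)

HasNF : Term → Set
HasNF t = Σ Term λ n → (t ⟶* n) × Normal n

data InertHead : Term → Set
data Inert     : Term → Set
data Fireball  : Term → Set

data InertHead where
  varApp : ∀ x {f} → Fireball f → InertHead (app (var x) f)
  iApp   : ∀ {i f} → InertHead i → Fireball f → InertHead (app i f)

data Inert where
  head : ∀ {i} → InertHead i → Inert i
  es   : ∀ {i i'} → Inert i → Inert i' → Inert (es i i')

data Fireball where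
  val   : ∀ {v} → IsValue v → Fireball v
  inert : ∀ {i} → Inert i → Fireball i
  es    : ∀ {f i} → Fireball f → Inert i → Fireball (es f i)

InertCtx : SCtx → Set
InertCtx I = All Inert I

data _⇓[_]_ : Term → ℕ → Term → Set where
  val    : ∀ {v} → IsValue v → v ⇓[ 0 ] v
  appβ   : ∀ {t u I s f k i} → InertCtx I →
           t ⇓[ k ] plug I (lam s) →
           es s (shift (length I) u) ⇓[ i ] f →
           app t u ⇓[ k + i + 1 ] plug I f
  appVar : ∀ {t u I x f k h} → InertCtx I →
           t ⇓[ k ] plug I (var x) →
           u ⇓[ h ] f →
           app t u ⇓[ k + h ] plug I (app (var x) (shift (length I) f))
  appIn  : ∀ {t u I i f k h} → InertCtx I → InertHead i →
           t ⇓[ k ] plug I i →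
           u ⇓[ h ] f →
           app t u ⇓[ k + h ] plug I (app i (shift (length I) f))
  esVal  : ∀ {t u I v f k i} → InertCtx I → IsValue v →
           u ⇓[ k ] plug I v →
           substUnder (length I) v t ⇓[ i ] f →
           es t u ⇓[ k + i + 1 ] plug I f
  esIn   : ∀ {t u f i k h} → Inert i →
           t ⇓[ k ] f →
           u ⇓[ h ] i →
           es t u ⇓[ k + h ] es f i

_⇓_ : Term → Term → Set
t ⇓ n = ∃ λ k → t ⇓[ k ] n

-- renaming 0 ↦ 0, (suc n) ↦ suc (suc n): makes index 1 unused
skip1 : ℕ → ℕ
skip1 zero    = zero
skip1 (suc n) = suc (suc n)

swap01 : ℕ → ℕ
swap01 zero          = suc zero
swap01 (suc zero)    = zero
swap01 (suc (suc n)) = suc (suc n)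

data _≡str_ : Term → Term → Set where
  -- axioms ("x ∉ fv(s)" is expressed by s being a weakening)
  axL   : ∀ t s u → es (app t (shift 1 s)) u ≡str app (es t u) s
  axR   : ∀ t s u → es (app (shift 1 t) s) u ≡str app t (es s u)
  axEs  : ∀ t u s → es (es (rename skip1 t) u) s ≡str es t (es u s)
  axCom : ∀ t s u → es (es t (shift 1 s)) u ≡str es (es (rename swap01 t) (shift 1 u)) s
  refl  : ∀ t → t ≡str t
  sym   : ∀ {t t'} → t ≡str t' → t' ≡str t
  trans : ∀ {t t' t''} → t ≡str t' → t' ≡str t'' → t ≡str t''
  appL  : ∀ {t t'} u → t ≡str t' → app t u ≡str app t' u
  appR  : ∀ t {u u'} → u ≡str u' → app t u ≡str app t u'
  lam   : ∀ {t t'} → t ≡str t' → lam t ≡str lam t'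
  esL   : ∀ {t t'} u → t ≡str t' → es t u ≡str es t' u
  esR   : ∀ t {u u'} → u ≡str u' → es t u ≡str es t u'

data NetClause (R : Term → Term → Set) (t t' : Term) : Set where
  diverge : ¬ HasNF t → NetClause R t t'
  var     : ∀ x → t ⇓ var x → t' ⇓ var x → NetClause R t t'
  lam     : ∀ t₁ t₁' → t ⇓ lam t₁ → t' ⇓ lam t₁' → R t₁ t₁' → NetClause R t t'
  app     : ∀ n₁ n₂ n' n₁' n₂' → t ⇓ app n₁ n₂ → t' ⇓ n' →
            n' ≡str app n₁' n₂' → R n₁ n₁' → R n₂ n₂' → NetClause R t t'
  es      : ∀ n₁ n₂ n' n₁' n₂' → t ⇓ es n₁ n₂ → t' ⇓ n' →
            n' ≡str es n₁' n₂' → R n₁ n₁' → R n₂ n₂' → NetClause R t t'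

NetSimulation : (Term → Term → Set) → Set
NetSimulation R = ∀ {t t'} → R t t' → NetClause R t t'

-- the largest net simulation = union of all net simulations
_≾net_ : Term → Term → Set₁
t ≾net t' = Σ (Term → Term → Set) λ R → NetSimulation R × R t t'

-- Multi types.  Multisets are represented by lists, identified up to
-- the (deep) multiset equivalence ≈ₘ defined below.

data LType : Set where
  _⊸_ : List LType → List LType → LType

MType : Set
MType = List LType

data _≈ₗ_ : LType → LType → Set
data _≈ₘ_ : MType → MType → Set

data _≈ₗ_ where
  arr : ∀ {M M' N N'} → M ≈ₘ M' → N ≈ₘ N' → (M ⊸ N) ≈ₗ (M' ⊸ N')

data _≈ₘ_ where
  []    : [] ≈ₘ []
  prep  : ∀ {L L' M M'} → L ≈ₗ L' → M ≈ₘ M' → (L ∷ M) ≈ₘ (L' ∷ M')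
  swap  : ∀ {L₁ L₁' L₂ L₂' M M'} → L₁ ≈ₗ L₁' → L₂ ≈ₗ L₂' → M ≈ₘ M' →
          (L₁ ∷ L₂ ∷ M) ≈ₘ (L₂' ∷ L₁' ∷ M')
  trans : ∀ {M M' M''} → M ≈ₘ M' → M' ≈ₘ M'' → M ≈ₘ M''

TCtx : Set
TCtx = ℕ → MType

_≈ᶜ_ : TCtx → TCtx → Set
Γ ≈ᶜ Δ = ∀ x → Γ x ≈ₘ Δ x

emptyCtx : TCtx
emptyCtx _ = []

_⊎ᶜ_ : TCtx → TCtx → TCtx
(Γ ⊎ᶜ Δ) x = Γ x ++ Δ x

single : ℕ → LType → TCtx
single x L y = if y ≡ᵇ x then L ∷ [] else []

_▸_ : TCtx → MType → TCtx
(Γ ▸ M) zero    = M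
(Γ ▸ M) (suc n) = Γ n

data _⊢ₗ_∶_ : TCtx → Term → LType → Set
data _⊢_∶_  : TCtx → Term → MType → Set

data _⊢ₗ_∶_ where
  ax  : ∀ x L → single x L ⊢ₗ var x ∶ L
  abs : ∀ {Γ M t N} → (Γ ▸ M) ⊢ t ∶ N → Γ ⊢ₗ lam t ∶ (M ⊸ N)

data _⊢_∶_ where
  -- many rule, as n-ary union built up one premise at a time
  manyNil  : ∀ {v} → IsValue v → emptyCtx ⊢ v ∶ []
  manyCons : ∀ {Γ Δ v L M} → Γ ⊢ₗ v ∶ L → Δ ⊢ v ∶ M → (Γ ⊎ᶜ Δ) ⊢ v ∶ (L ∷ M)
  appT     : ∀ {Γ Δ t u M N} → Γ ⊢ t ∶ ((M ⊸ N) ∷ []) → Δ ⊢ u ∶ M →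
             (Γ ⊎ᶜ Δ) ⊢ app t u ∶ N
  esT      : ∀ {Γ Δ t u M N} → (Γ ▸ M) ⊢ t ∶ N → Δ ⊢ u ∶ M →
             (Γ ⊎ᶜ Δ) ⊢ es t u ∶ N
  conv     : ∀ {Γ Γ' t M M'} → Γ ≈ᶜ Γ' → M ≈ₘ M' → Γ ⊢ t ∶ M → Γ' ⊢ t ∶ M'

_≾type_ : Term → Term → Set
t ≾type t' = ∀ Γ M → Γ ⊢ t ∶ M → Γ ⊢ t' ∶ M

-- Multi types are invariant under big-step evaluation in both directions
-- (subject reduction and expansion, resting on a substitution lemma for
-- values and its converse) and under structural equivalence, and typable
-- terms normalise, so the divergent clause of a net simulation never applies
-- to a typable term.  Given t R t', a typing of t thus becomes a typing of its
-- normal form, which splits into typings of the components of that normal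
-- form; R relates these to the components of the normal form of t' (up to
-- ≡str), so by induction on the size of derivations they transfer, and
-- reassembling and expanding yields a typing of t'.  Part (2) is part (1)
-- for the net simulation witnessing t ≾net t'.

module Submission where

open import Defs
open import Data.Bool using (true; false; if_then_else_)
open import Data.Empty using (⊥-elim)
open import Data.List using ([]; _∷_; _++_; length)
open import Data.List.Properties using (++-assoc; ++-identityʳ)
open import Data.Maybe using (Maybe; just; nothing; maybe′)
import Data.Maybe as Maybe
open import Data.Maybe.Properties using (just-injective)
open import Data.Nat using (ℕ; zero; suc; _+_; _≤_; _<_; _≡ᵇ_; z≤n; s≤s)
open import Data.Nat.Properties
  using ( _≟_; ≡ᵇ⇒≡; ≡⇒≡ᵇ; +-assoc; +-suc; +-identityʳ; +-commutativeSemigroup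
        ; +-monoʳ-≤; +-monoˡ-≤; ≤-refl; ≤-reflexive; ≤-trans; ≤-pred; m≤m+n; m≤n+m; n≤1+n )
open import Algebra.Properties.CommutativeSemigroup +-commutativeSemigroup
  using (interchange; x∙yz≈y∙xz; xy∙z≈xz∙y)
open import Data.Product using (Σ; _×_; _,_; proj₁; proj₂)
open import Data.Sum using (_⊎_; inj₁; inj₂)
open import Relation.Binary.Construct.Closure.ReflexiveTransitive using (ε; _◅_)
open import Relation.Nullary using (¬_; Dec; yes; no)
import Relation.Binary.PropositionalEquality as ≡
open ≡ using (_≡_; _≢_; refl)

≈ₗ-refl : ∀ L → L ≈ₗ L
≈ₘ-refl : ∀ M → M ≈ₘ M
≈ₗ-refl (M ⊸ N) = arr (≈ₘ-refl M) (≈ₘ-refl N)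
≈ₘ-refl []      = []
≈ₘ-refl (L ∷ M) = prep (≈ₗ-refl L) (≈ₘ-refl M)

≈ₗ-sym : ∀ {L L'} → L ≈ₗ L' → L' ≈ₗ L
≈ₘ-sym : ∀ {M M'} → M ≈ₘ M' → M' ≈ₘ M
≈ₗ-sym (arr p q)    = arr (≈ₘ-sym p) (≈ₘ-sym q)
≈ₘ-sym []           = []
≈ₘ-sym (prep p q)   = prep (≈ₗ-sym p) (≈ₘ-sym q)
≈ₘ-sym (swap p q r) = swap (≈ₗ-sym q) (≈ₗ-sym p) (≈ₘ-sym r)
≈ₘ-sym (trans p q)  = trans (≈ₘ-sym q) (≈ₘ-sym p)

≡⇒≈ₘ : ∀ {M N} → M ≡ N → M ≈ₘ N
≡⇒≈ₘ {M} refl = ≈ₘ-refl M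

++-congₘ : ∀ {M M' N N'} → M ≈ₘ M' → N ≈ₘ N' → (M ++ N) ≈ₘ (M' ++ N')
++-congₘ []            q = q
++-congₘ (prep p p')   q = prep p (++-congₘ p' q)
++-congₘ (swap p p' r) q = swap p p' (++-congₘ r q)
++-congₘ {N' = N'} (trans p p') q = trans (++-congₘ p q) (++-congₘ p' (≈ₘ-refl N'))

++-commₘ : ∀ M N → (M ++ N) ≈ₘ (N ++ M)
++-commₘ []      N = ≡⇒≈ₘ (≡.sym (++-identityʳ N))
++-commₘ (L ∷ M) N = trans (prep (≈ₗ-refl L) (++-commₘ M N)) (∷-move N M)
  where
  ∷-move : ∀ M N → (L ∷ (M ++ N)) ≈ₘ (M ++ (L ∷ N))
  ∷-move []       N = ≈ₘ-refl (L ∷ N)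
  ∷-move (L' ∷ M) N = trans (swap (≈ₗ-refl L) (≈ₗ-refl L') (≈ₘ-refl (M ++ N)))
                            (prep (≈ₗ-refl L') (∷-move M N))

≈ᶜ-refl : ∀ {Γ} → Γ ≈ᶜ Γ
≈ᶜ-refl {Γ} x = ≈ₘ-refl (Γ x)

≈ᶜ-sym : ∀ {Γ Δ} → Γ ≈ᶜ Δ → Δ ≈ᶜ Γ
≈ᶜ-sym p x = ≈ₘ-sym (p x)

≈ᶜ-trans : ∀ {Γ Δ Θ} → Γ ≈ᶜ Δ → Δ ≈ᶜ Θ → Γ ≈ᶜ Θ
≈ᶜ-trans p q x = trans (p x) (q x)

⊎ᶜ-cong : ∀ {Γ Γ' Δ Δ'} → Γ ≈ᶜ Γ' → Δ ≈ᶜ Δ' → (Γ ⊎ᶜ Δ) ≈ᶜ (Γ' ⊎ᶜ Δ')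
⊎ᶜ-cong p q x = ++-congₘ (p x) (q x)

⊎ᶜ-comm : ∀ Γ Δ → (Γ ⊎ᶜ Δ) ≈ᶜ (Δ ⊎ᶜ Γ)
⊎ᶜ-comm Γ Δ x = ++-commₘ (Γ x) (Δ x)

⊎ᶜ-assoc : ∀ Γ Δ Θ → ((Γ ⊎ᶜ Δ) ⊎ᶜ Θ) ≈ᶜ (Γ ⊎ᶜ (Δ ⊎ᶜ Θ))
⊎ᶜ-assoc Γ Δ Θ x = ≡⇒≈ₘ (++-assoc (Γ x) (Δ x) (Θ x))

⊎ᶜ-identityʳ : ∀ Γ → (Γ ⊎ᶜ emptyCtx) ≈ᶜ Γ
⊎ᶜ-identityʳ Γ x = ≡⇒≈ₘ (++-identityʳ (Γ x))

⊎ᶜ-swapʳ : ∀ Γ Δ Θ → ((Γ ⊎ᶜ Δ) ⊎ᶜ Θ) ≈ᶜ ((Γ ⊎ᶜ Θ) ⊎ᶜ Δ)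
⊎ᶜ-swapʳ Γ Δ Θ =
  ≈ᶜ-trans (⊎ᶜ-assoc Γ Δ Θ)
  (≈ᶜ-trans (⊎ᶜ-cong (≈ᶜ-refl {Γ}) (⊎ᶜ-comm Δ Θ)) (≈ᶜ-sym (⊎ᶜ-assoc Γ Θ Δ)))

⊎ᶜ-interchange : ∀ Γ Δ Θ Ξ → ((Γ ⊎ᶜ Δ) ⊎ᶜ (Θ ⊎ᶜ Ξ)) ≈ᶜ ((Γ ⊎ᶜ Θ) ⊎ᶜ (Δ ⊎ᶜ Ξ))
⊎ᶜ-interchange Γ Δ Θ Ξ =
  ≈ᶜ-trans (≈ᶜ-sym (⊎ᶜ-assoc (Γ ⊎ᶜ Δ) Θ Ξ))
  (≈ᶜ-trans (⊎ᶜ-cong (⊎ᶜ-swapʳ Γ Δ Θ) (≈ᶜ-refl {Ξ})) (⊎ᶜ-assoc (Γ ⊎ᶜ Θ) Δ Ξ))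

tailᶜ : TCtx → TCtx
tailᶜ Γ n = Γ (suc n)

▸-cong : ∀ {Γ Δ M N} → Γ ≈ᶜ Δ → M ≈ₘ N → (Γ ▸ M) ≈ᶜ (Δ ▸ N)
▸-cong p q zero    = q
▸-cong p q (suc x) = p x

▸-⊎ᶜ : ∀ Γ Δ M N → ((Γ ▸ M) ⊎ᶜ (Δ ▸ N)) ≈ᶜ ((Γ ⊎ᶜ Δ) ▸ (M ++ N))
▸-⊎ᶜ Γ Δ M N zero    = ≈ₘ-refl (M ++ N)
▸-⊎ᶜ Γ Δ M N (suc x) = ≈ₘ-refl (Γ x ++ Δ x)

▸-⊎ᶜ-[]ʳ : ∀ Γ Δ M → ((Γ ▸ M) ⊎ᶜ (Δ ▸ [])) ≈ᶜ ((Γ ⊎ᶜ Δ) ▸ M)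
▸-⊎ᶜ-[]ʳ Γ Δ M = ≈ᶜ-trans (▸-⊎ᶜ Γ Δ M []) (▸-cong ≈ᶜ-refl (≡⇒≈ₘ (++-identityʳ M)))

▸-η : ∀ Γ → Γ ≈ᶜ (tailᶜ Γ ▸ Γ zero)
▸-η Γ zero    = ≈ₘ-refl (Γ zero)
▸-η Γ (suc x) = ≈ₘ-refl (Γ (suc x))

infix 6 _↦_

_↦_ : ℕ → MType → TCtx
(x ↦ M) y = if y ≡ᵇ x then M else []

↦-self : ∀ x M → (x ↦ M) x ≡ M
↦-self x M with x ≡ᵇ x | ≡⇒≡ᵇ x x refl
... | true | _ = refl

↦-other : ∀ {x y} M → y ≢ x → (x ↦ M) y ≡ []
↦-other {x} {y} M y≢x with y ≡ᵇ x | ≡ᵇ⇒≡ y x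
... | false | _    = refl
... | true  | y≡x = ⊥-elim (y≢x (y≡x _))

↦-⊎ᶜ : ∀ x M N → ((x ↦ M) ⊎ᶜ (x ↦ N)) ≈ᶜ (x ↦ (M ++ N))
↦-⊎ᶜ x M N y with y ≡ᵇ x
... | true  = ≈ₘ-refl (M ++ N)
... | false = []

↦-[] : ∀ x → emptyCtx ≈ᶜ (x ↦ [])
↦-[] x y with y ≡ᵇ x
... | true  = []
... | false = []

↦-cong : ∀ x {M N} → M ≈ₘ N → (x ↦ M) ≈ᶜ (x ↦ N)
↦-cong x p y with y ≡ᵇ x
... | true  = p
... | false = []

-- Injective renamings whose image is decidable, witnessed by a partial
-- inverse; contexts can then be transported along them.
record Embedding : Set where
  field
    ι     : ℕ → ℕ
    ι⁻¹   : ℕ → Maybe ℕ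
    ι⁻¹-ι : ∀ x → ι⁻¹ (ι x) ≡ just x
    ι-ι⁻¹ : ∀ {y x} → ι⁻¹ y ≡ just x → ι x ≡ y
open Embedding public

ι-injective : ∀ R {x y} → ι R x ≡ ι R y → x ≡ y
ι-injective R {x} {y} e =
  just-injective (≡.trans (≡.sym (ι⁻¹-ι R x)) (≡.trans (≡.cong (ι⁻¹ R) e) (ι⁻¹-ι R y)))

lift : Embedding → Embedding
lift R = record { ι = liftRen (ι R) ; ι⁻¹ = inv ; ι⁻¹-ι = inv-ι ; ι-ι⁻¹ = ι-inv _ }
  where
  inv : ℕ → Maybe ℕ
  inv zero    = just zero
  inv (suc y) = Maybe.map suc (ι⁻¹ R y)
  inv-ι : ∀ x → inv (liftRen (ι R) x) ≡ just x
  inv-ι zero    = refl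
  inv-ι (suc x) = ≡.cong (Maybe.map suc) (ι⁻¹-ι R x)
  ι-inv : ∀ y {x} → inv y ≡ just x → liftRen (ι R) x ≡ y
  ι-inv zero    refl = refl
  ι-inv (suc y) e with ι⁻¹ R y in eq
  ι-inv (suc y) refl | just z = ≡.cong suc (ι-ι⁻¹ R eq)

weaken : ℕ → Embedding
weaken k = record { ι = k +_ ; ι⁻¹ = inv k ; ι⁻¹-ι = inv-ι k ; ι-ι⁻¹ = ι-inv k _ }
  where
  inv : ℕ → ℕ → Maybe ℕ
  inv zero    y       = just y
  inv (suc k) zero    = nothing
  inv (suc k) (suc y) = inv k y
  inv-ι : ∀ k x → inv k (k + x) ≡ just x
  inv-ι zero    x = refl
  inv-ι (suc k) x = inv-ι k x
  ι-inv : ∀ k y {x} → inv k y ≡ just x → k + x ≡ y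
  ι-inv zero    y       refl = refl
  ι-inv (suc k) (suc y) e    = ≡.cong suc (ι-inv k y e)

skip : ℕ → Embedding
skip zero    = weaken 1
skip (suc j) = lift (skip j)

skip1ᵉ : Embedding
skip1ᵉ = record { ι = skip1 ; ι⁻¹ = inv ; ι⁻¹-ι = inv-ι ; ι-ι⁻¹ = ι-inv _ }
  where
  inv : ℕ → Maybe ℕ
  inv zero          = just zero
  inv (suc zero)    = nothing
  inv (suc (suc n)) = just (suc n)
  inv-ι : ∀ x → inv (skip1 x) ≡ just x
  inv-ι zero    = refl
  inv-ι (suc x) = refl
  ι-inv : ∀ y {x} → inv y ≡ just x → skip1 x ≡ y
  ι-inv zero          refl = refl
  ι-inv (suc (suc y)) refl = refl

swap01-involutive : ∀ x → swap01 (swap01 x) ≡ x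
swap01-involutive zero          = refl
swap01-involutive (suc zero)    = refl
swap01-involutive (suc (suc x)) = refl

swap01ᵉ : Embedding
swap01ᵉ = record
  { ι = swap01 ; ι⁻¹ = λ y → just (swap01 y)
  ; ι⁻¹-ι = λ x → ≡.cong just (swap01-involutive x)
  ; ι-ι⁻¹ = λ {y} e → ≡.trans (≡.cong swap01 (≡.sym (just-injective e))) (swap01-involutive y)
  }

pushWith : Embedding → MType → TCtx → TCtx
pushWith R D Γ y = maybe′ Γ D (ι⁻¹ R y)

push : Embedding → TCtx → TCtx
push R = pushWith R []

insert : ℕ → MType → TCtx → TCtx
insert j = pushWith (skip j)

pull : Embedding → TCtx → TCtx
pull R Θ x = Θ (ι R x)

pushWith-ι : ∀ R D Γ x → pushWith R D Γ (ι R x) ≡ Γ x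
pushWith-ι R D Γ x rewrite ι⁻¹-ι R x = refl

pushWith-⊎ᶜ : ∀ R D D' Γ Δ → pushWith R (D ++ D') (Γ ⊎ᶜ Δ) ≈ᶜ (pushWith R D Γ ⊎ᶜ pushWith R D' Δ)
pushWith-⊎ᶜ R D D' Γ Δ y with ι⁻¹ R y
... | just x  = ≈ₘ-refl (Γ x ++ Δ x)
... | nothing = ≈ₘ-refl (D ++ D')

push-⊎ᶜ : ∀ R Γ Δ → push R (Γ ⊎ᶜ Δ) ≈ᶜ (push R Γ ⊎ᶜ push R Δ)
push-⊎ᶜ R = pushWith-⊎ᶜ R [] []

pushWith-cong : ∀ R {D D' Γ Γ'} → D ≈ₘ D' → Γ ≈ᶜ Γ' → pushWith R D Γ ≈ᶜ pushWith R D' Γ'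
pushWith-cong R p q y with ι⁻¹ R y
... | just x  = q x
... | nothing = p

push-cong : ∀ R {Γ Γ'} → Γ ≈ᶜ Γ' → push R Γ ≈ᶜ push R Γ'
push-cong R = pushWith-cong R []

pushWith-lift : ∀ R D Γ M → pushWith (lift R) D (Γ ▸ M) ≈ᶜ (pushWith R D Γ ▸ M)
pushWith-lift R D Γ M zero = ≈ₘ-refl M
pushWith-lift R D Γ M (suc y) with ι⁻¹ R y
... | just x  = ≈ₘ-refl (Γ x)
... | nothing = ≈ₘ-refl D

push-lift-tail : ∀ R Γ y → push (lift R) Γ (suc y) ≡ push R (tailᶜ Γ) y
push-lift-tail R Γ y with ι⁻¹ R y
... | just z  = refl
... | nothing = refl

push-empty : ∀ R → push R emptyCtx ≈ᶜ emptyCtx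
push-empty R y with ι⁻¹ R y
... | just x  = []
... | nothing = []

↦-ι : ∀ R x M → (λ y → (ι R x ↦ M) (ι R y)) ≈ᶜ (x ↦ M)
↦-ι R x M y with y ≟ x
... | yes refl = ≡⇒≈ₘ (≡.trans (↦-self (ι R x) M) (≡.sym (↦-self x M)))
... | no y≢x  = ≡⇒≈ₘ (≡.trans (↦-other M (λ e → y≢x (ι-injective R e))) (≡.sym (↦-other M y≢x)))

push-↦ : ∀ R x M → push R (x ↦ M) ≈ᶜ (ι R x ↦ M)
push-↦ R x M y with ι⁻¹ R y in eq
... | just z rewrite ≡.sym (ι-ι⁻¹ R eq) = ≈ₘ-sym (↦-ι R x M z)
... | nothing = ≡⇒≈ₘ (≡.sym (↦-other M ι⁻¹≢))
  where
  ι⁻¹≢ : y ≢ ι R x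
  ι⁻¹≢ e with ≡.trans (≡.sym eq) (≡.trans (≡.cong (ι⁻¹ R) e) (ι⁻¹-ι R x))
  ... | ()

ι⁻¹-skip-self : ∀ j → ι⁻¹ (skip j) j ≡ nothing
ι⁻¹-skip-self zero = refl
ι⁻¹-skip-self (suc j) rewrite ι⁻¹-skip-self j = refl

ι⁻¹-skip-nothing : ∀ j {y} → ι⁻¹ (skip j) y ≡ nothing → y ≡ j
ι⁻¹-skip-nothing zero    {zero}  e = refl
ι⁻¹-skip-nothing (suc j) {suc y} e with ι⁻¹ (skip j) y in eq
... | nothing = ≡.cong suc (ι⁻¹-skip-nothing j eq)

ι-skip-≢ : ∀ j x → ι (skip j) x ≢ j
ι-skip-≢ j x e with ≡.trans (≡.sym (ι⁻¹-ι (skip j) x)) (≡.trans (≡.cong (ι⁻¹ (skip j)) e) (ι⁻¹-skip-self j))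
... | ()

skip-view : ∀ j i → i ≡ j ⊎ Σ ℕ λ i' → i ≡ ι (skip j) i'
skip-view j i with ι⁻¹ (skip j) i in eq
... | just i' = inj₂ (i' , ≡.sym (ι-ι⁻¹ (skip j) eq))
... | nothing = inj₁ (ι⁻¹-skip-nothing j eq)

insert-self : ∀ j M Γ → insert j M Γ j ≡ M
insert-self j M Γ rewrite ι⁻¹-skip-self j = refl

insert-remove : ∀ j Γ → Γ ≈ᶜ insert j (Γ j) (pull (skip j) Γ)
insert-remove j Γ y with ι⁻¹ (skip j) y in eq
... | just x  = ≡⇒≈ₘ (≡.cong Γ (≡.sym (ι-ι⁻¹ (skip j) eq)))
... | nothing rewrite ι⁻¹-skip-nothing j eq = ≈ₘ-refl (Γ j)

insert-↦ : ∀ j N → insert j N emptyCtx ≈ᶜ (j ↦ N)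
insert-↦ j N y with ι⁻¹ (skip j) y in eq
... | just x  = ≡⇒≈ₘ (≡.sym (↦-other N (λ e → ι-skip-≢ j x (≡.trans (ι-ι⁻¹ (skip j) eq) e))))
... | nothing rewrite ι⁻¹-skip-nothing j eq = ≡⇒≈ₘ (≡.sym (↦-self j N))

▸-insert-0 : ∀ M Γ → (Γ ▸ M) ≈ᶜ insert 0 M Γ
▸-insert-0 M Γ zero    = ≈ₘ-refl M
▸-insert-0 M Γ (suc y) = ≈ₘ-refl (Γ y)

push-weaken-▸ : ∀ k Δ → push (weaken k) (Δ ▸ []) ≈ᶜ push (weaken (suc k)) Δ
push-weaken-▸ zero    Δ zero    = []
push-weaken-▸ zero    Δ (suc y) = ≈ₘ-refl (Δ y)
push-weaken-▸ (suc k) Δ zero    = []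
push-weaken-▸ (suc k) Δ (suc y) = push-weaken-▸ k Δ y

push-weaken-suc : ∀ k Δ → push (weaken (suc k)) Δ ≈ᶜ (push (weaken k) Δ ▸ [])
push-weaken-suc k Δ zero    = []
push-weaken-suc k Δ (suc y) = ≈ₘ-refl (push (weaken k) Δ y)

liftRen-ext : ∀ {ρ ρ' : ℕ → ℕ} → (∀ x → ρ x ≡ ρ' x) → ∀ x → liftRen ρ x ≡ liftRen ρ' x
liftRen-ext e zero    = refl
liftRen-ext e (suc x) = ≡.cong suc (e x)

rename-ext : ∀ {ρ ρ' : ℕ → ℕ} → (∀ x → ρ x ≡ ρ' x) → ∀ t → rename ρ t ≡ rename ρ' t
rename-ext e (var x)   = ≡.cong var (e x)
rename-ext e (lam t)   = ≡.cong lam (rename-ext (liftRen-ext e) t)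
rename-ext e (app t u) = ≡.cong₂ app (rename-ext e t) (rename-ext e u)
rename-ext e (es t u)  = ≡.cong₂ es (rename-ext (liftRen-ext e) t) (rename-ext e u)

liftRen-id : ∀ x → liftRen (λ y → y) x ≡ x
liftRen-id zero    = refl
liftRen-id (suc x) = refl

rename-id : ∀ t → rename (λ x → x) t ≡ t
rename-id (var x)   = refl
rename-id (lam t)   = ≡.cong lam (≡.trans (rename-ext liftRen-id t) (rename-id t))
rename-id (app t u) = ≡.cong₂ app (rename-id t) (rename-id u)
rename-id (es t u)  = ≡.cong₂ es (≡.trans (rename-ext liftRen-id t) (rename-id t)) (rename-id u)

liftRen-∘ : ∀ (ρ ρ' : ℕ → ℕ) x → liftRen ρ (liftRen ρ' x) ≡ liftRen (λ y → ρ (ρ' y)) x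
liftRen-∘ ρ ρ' zero    = refl
liftRen-∘ ρ ρ' (suc x) = refl

rename-∘ : ∀ (ρ ρ' : ℕ → ℕ) t → rename ρ (rename ρ' t) ≡ rename (λ y → ρ (ρ' y)) t
rename-∘ ρ ρ' (var x)   = refl
rename-∘ ρ ρ' (lam t)   =
  ≡.cong lam (≡.trans (rename-∘ (liftRen ρ) (liftRen ρ') t) (rename-ext (liftRen-∘ ρ ρ') t))
rename-∘ ρ ρ' (app t u) = ≡.cong₂ app (rename-∘ ρ ρ' t) (rename-∘ ρ ρ' u)
rename-∘ ρ ρ' (es t u)  =
  ≡.cong₂ es (≡.trans (rename-∘ (liftRen ρ) (liftRen ρ') t) (rename-ext (liftRen-∘ ρ ρ') t))
             (rename-∘ ρ ρ' u)

rename-swap01-involutive : ∀ t → rename swap01 (rename swap01 t) ≡ t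
rename-swap01-involutive t =
  ≡.trans (rename-∘ swap01 swap01 t) (≡.trans (rename-ext swap01-involutive t) (rename-id t))

liftSub-ext : ∀ {σ σ' : ℕ → Term} → (∀ x → σ x ≡ σ' x) → ∀ x → liftSub σ x ≡ liftSub σ' x
liftSub-ext e zero    = refl
liftSub-ext e (suc x) = ≡.cong (rename suc) (e x)

subst-ext : ∀ {σ σ' : ℕ → Term} → (∀ x → σ x ≡ σ' x) → ∀ t → subst σ t ≡ subst σ' t
subst-ext e (var x)   = e x
subst-ext e (lam t)   = ≡.cong lam (subst-ext (liftSub-ext e) t)
subst-ext e (app t u) = ≡.cong₂ app (subst-ext e t) (subst-ext e u)
subst-ext e (es t u)  = ≡.cong₂ es (subst-ext (liftSub-ext e) t) (subst-ext e u)

liftSub-liftRen : ∀ (σ : ℕ → Term) (ρ : ℕ → ℕ) x → liftSub σ (liftRen ρ x) ≡ liftSub (λ y → σ (ρ y)) x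
liftSub-liftRen σ ρ zero    = refl
liftSub-liftRen σ ρ (suc x) = refl

subst-rename : ∀ (σ : ℕ → Term) (ρ : ℕ → ℕ) t → subst σ (rename ρ t) ≡ subst (λ y → σ (ρ y)) t
subst-rename σ ρ (var x)   = refl
subst-rename σ ρ (lam t)   =
  ≡.cong lam (≡.trans (subst-rename (liftSub σ) (liftRen ρ) t) (subst-ext (liftSub-liftRen σ ρ) t))
subst-rename σ ρ (app t u) = ≡.cong₂ app (subst-rename σ ρ t) (subst-rename σ ρ u)
subst-rename σ ρ (es t u)  =
  ≡.cong₂ es (≡.trans (subst-rename (liftSub σ) (liftRen ρ) t) (subst-ext (liftSub-liftRen σ ρ) t))
             (subst-rename σ ρ u)

-- (j ≔ w): substitute w for the index j of a term living under j binders
_≔_ : ℕ → Term → ℕ → Term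
(zero  ≔ w) zero    = w
(zero  ≔ w) (suc n) = var n
(suc j ≔ w)         = liftSub (j ≔ w)

≔-self : ∀ j w → (j ≔ w) j ≡ shift j w
≔-self zero    w = ≡.sym (≡.trans (rename-ext (λ x → refl) w) (rename-id w))
≔-self (suc j) w = ≡.trans (≡.cong (rename suc) (≔-self j w)) (rename-∘ suc (j +_) w)

≔-skip : ∀ j w i → (j ≔ w) (ι (skip j) i) ≡ var i
≔-skip zero    w i       = refl
≔-skip (suc j) w zero    = refl
≔-skip (suc j) w (suc i) = ≡.cong (rename suc) (≔-skip j w i)

substUnder-≔ : ∀ k v t → substUnder k v t ≡ subst (0 ≔ v) (rename (liftRen (k +_)) t)
substUnder-≔ k v t = ≡.trans (subst-ext σ-eq t) (≡.sym (subst-rename (0 ≔ v) (liftRen (k +_)) t))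
  where
  σ-eq : ∀ x → _ ≡ (0 ≔ v) (liftRen (k +_) x)
  σ-eq zero    = refl
  σ-eq (suc n) = refl

-- Derivations indexed by an upper bound on their size (rule up): reduction
-- strictly decreases the bound, and evaluation does not increase it.
infix 4 _⊢ₗ[_]_∶_ _⊢[_]_∶_ _⊢ˢ_∶_

data _⊢ₗ[_]_∶_ : TCtx → ℕ → Term → LType → Set
data _⊢[_]_∶_  : TCtx → ℕ → Term → MType → Set

data _⊢ₗ[_]_∶_ where
  ax  : ∀ x L → single x L ⊢ₗ[ 0 ] var x ∶ L
  abs : ∀ {Γ M t N k} → (Γ ▸ M) ⊢[ k ] t ∶ N → Γ ⊢ₗ[ suc k ] lam t ∶ (M ⊸ N)

data _⊢[_]_∶_ where
  manyNil  : ∀ {v} → IsValue v → emptyCtx ⊢[ 0 ] v ∶ []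
  manyCons : ∀ {Γ Δ v L M k h} → Γ ⊢ₗ[ k ] v ∶ L → Δ ⊢[ h ] v ∶ M →
             (Γ ⊎ᶜ Δ) ⊢[ k + h ] v ∶ (L ∷ M)
  appT     : ∀ {Γ Δ t u M N k h} → Γ ⊢[ k ] t ∶ ((M ⊸ N) ∷ []) → Δ ⊢[ h ] u ∶ M →
             (Γ ⊎ᶜ Δ) ⊢[ suc (k + h) ] app t u ∶ N
  esT      : ∀ {Γ Δ t u M N k h} → (Γ ▸ M) ⊢[ k ] t ∶ N → Δ ⊢[ h ] u ∶ M →
             (Γ ⊎ᶜ Δ) ⊢[ suc (k + h) ] es t u ∶ N
  conv     : ∀ {Γ Γ' t M M' k} → Γ ≈ᶜ Γ' → M ≈ₘ M' → Γ ⊢[ k ] t ∶ M → Γ' ⊢[ k ] t ∶ M'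
  up       : ∀ {Γ t M k k'} → k ≤ k' → Γ ⊢[ k ] t ∶ M → Γ ⊢[ k' ] t ∶ M

_⊢ˢ_∶_ : TCtx → Term → MType → Set
Γ ⊢ˢ t ∶ M = Σ ℕ λ k → Γ ⊢[ k ] t ∶ M

resize : ∀ {Γ t M k k'} → k ≡ k' → Γ ⊢[ k ] t ∶ M → Γ ⊢[ k' ] t ∶ M
resize e d = up (≤-reflexive e) d

convᶜ : ∀ {Γ Γ' t M k} → Γ ≈ᶜ Γ' → Γ ⊢[ k ] t ∶ M → Γ' ⊢[ k ] t ∶ M
convᶜ {M = M} p d = conv p (≈ₘ-refl M) d

cast : ∀ {Γ t t' M k} → t ≡ t' → Γ ⊢[ k ] t ∶ M → Γ ⊢[ k ] t' ∶ M
cast refl d = d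

sizedₗ : ∀ {Γ t L} → Γ ⊢ₗ t ∶ L → Σ ℕ λ k → Γ ⊢ₗ[ k ] t ∶ L
sized  : ∀ {Γ t M} → Γ ⊢ t ∶ M → Γ ⊢ˢ t ∶ M
sizedₗ (Defs.ax x L) = 0 , ax x L
sizedₗ (Defs.abs d) with sized d
... | k , d' = suc k , abs d'
sized (Defs.manyNil v) = 0 , manyNil v
sized (Defs.manyCons d e) with sizedₗ d | sized e
... | k , d' | h , e' = k + h , manyCons d' e'
sized (Defs.appT d e) with sized d | sized e
... | k , d' | h , e' = _ , appT d' e'
sized (Defs.esT d e) with sized d | sized e
... | k , d' | h , e' = _ , esT d' e'
sized (Defs.conv p q d) with sized d
... | k , d' = k , conv p q d'

unsizedₗ : ∀ {Γ t L k} → Γ ⊢ₗ[ k ] t ∶ L → Γ ⊢ₗ t ∶ L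
unsized  : ∀ {Γ t M k} → Γ ⊢[ k ] t ∶ M → Γ ⊢ t ∶ M
unsizedₗ (ax x L) = Defs.ax x L
unsizedₗ (abs d)  = Defs.abs (unsized d)
unsized (manyNil v)    = Defs.manyNil v
unsized (manyCons d e) = Defs.manyCons (unsizedₗ d) (unsized e)
unsized (appT d e)     = Defs.appT (unsized d) (unsized e)
unsized (esT d e)      = Defs.esT (unsized d) (unsized e)
unsized (conv p q d)   = Defs.conv p q (unsized d)
unsized (up _ d)       = unsized d

data Many : TCtx → Term → MType → ℕ → Set where
  mnil  : ∀ {v} → IsValue v → Many emptyCtx v [] 0
  mcons : ∀ {Γ Δ v L M k h} → Γ ⊢ₗ[ k ] v ∶ L → Many Δ v M h → Many (Γ ⊎ᶜ Δ) v (L ∷ M) (k + h)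

Many⇒⊢ : ∀ {Γ v M k} → Many Γ v M k → Γ ⊢[ k ] v ∶ M
Many⇒⊢ (mnil v)    = manyNil v
Many⇒⊢ (mcons d m) = manyCons d (Many⇒⊢ m)

⊢ₗ-≈ₗ : ∀ {Γ v L L' k} → Γ ⊢ₗ[ k ] v ∶ L → L ≈ₗ L' → Σ TCtx λ Γ' → (Γ' ⊢ₗ[ k ] v ∶ L') × (Γ ≈ᶜ Γ')
⊢ₗ-≈ₗ (ax x L) p        = single x _ , ax x _ , ↦-cong x (prep p [])
⊢ₗ-≈ₗ (abs d) (arr p q) = _ , abs (conv (▸-cong ≈ᶜ-refl p) q d) , ≈ᶜ-refl

Many-≈ₘ : ∀ {Γ v M M' k} → Many Γ v M k → M ≈ₘ M' → Σ TCtx λ Γ' → Many Γ' v M' k × (Γ ≈ᶜ Γ')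
Many-≈ₘ (mnil v) [] = emptyCtx , mnil v , ≈ᶜ-refl
Many-≈ₘ (mcons d m) (prep p q) with ⊢ₗ-≈ₗ d p | Many-≈ₘ m q
... | Γ₁ , d' , g₁ | Γ₂ , m' , g₂ = (Γ₁ ⊎ᶜ Γ₂) , mcons d' m' , ⊎ᶜ-cong g₁ g₂
Many-≈ₘ (mcons {Γ = G₁} {k = k₁} d₁ (mcons {Γ = G₂} {Δ = D} {k = k₂} {h = h} d₂ m)) (swap p q r)
  with ⊢ₗ-≈ₗ d₁ p | ⊢ₗ-≈ₗ d₂ q | Many-≈ₘ m r
... | Γ₁ , d₁' , g₁ | Γ₂ , d₂' , g₂ | Γ₃ , m' , g₃ =
  (Γ₂ ⊎ᶜ (Γ₁ ⊎ᶜ Γ₃)) , ≡.subst (Many _ _ _) (x∙yz≈y∙xz k₂ k₁ h) (mcons d₂' (mcons d₁' m')) ,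
  ≈ᶜ-trans (≈ᶜ-sym (⊎ᶜ-assoc G₁ G₂ D))
  (≈ᶜ-trans (⊎ᶜ-cong (⊎ᶜ-comm G₁ G₂) ≈ᶜ-refl)
  (≈ᶜ-trans (⊎ᶜ-assoc G₂ G₁ D) (⊎ᶜ-cong g₂ (⊎ᶜ-cong g₁ g₃))))
Many-≈ₘ m (trans p q) with Many-≈ₘ m p
... | Γ₁ , m' , g₁ with Many-≈ₘ m' q
... | Γ₂ , m'' , g₂ = Γ₂ , m'' , ≈ᶜ-trans g₁ g₂

record ValueInv (Γ : TCtx) (k : ℕ) (v : Term) (M : MType) : Set where
  constructor mkValueInv
  field
    Γ'   : TCtx
    k'   : ℕ
    many : Many Γ' v M k'
    ctx  : Γ ≈ᶜ Γ'
    size : k' ≤ k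

value-inversion-≈ : ∀ {Γ v M k} → IsValue v → Γ ⊢[ k ] v ∶ M → Σ MType λ M' → ValueInv Γ k v M' × (M ≈ₘ M')
value-inversion-≈ _ (manyNil v) = [] , mkValueInv emptyCtx 0 (mnil v) ≈ᶜ-refl z≤n , []
value-inversion-≈ iv (manyCons {L = L} {k = k₁} d e) with value-inversion-≈ iv e
... | M' , mkValueInv Γ' k' m g le , p =
  L ∷ M' , mkValueInv _ (k₁ + k') (mcons d m) (⊎ᶜ-cong ≈ᶜ-refl g) (+-monoʳ-≤ k₁ le) , prep (≈ₗ-refl L) p
value-inversion-≈ iv (conv g p d) with value-inversion-≈ iv d
... | M' , mkValueInv Γ' k' m g' le , p' = M' , mkValueInv Γ' k' m (≈ᶜ-trans (≈ᶜ-sym g) g') le , trans (≈ₘ-sym p) p'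
value-inversion-≈ iv (up le d) with value-inversion-≈ iv d
... | M' , mkValueInv Γ' k' m g le' , p = M' , mkValueInv Γ' k' m g (≤-trans le' le) , p

value-inversion : ∀ {Γ v M k} → IsValue v → Γ ⊢[ k ] v ∶ M → ValueInv Γ k v M
value-inversion iv d with value-inversion-≈ iv d
... | M' , mkValueInv Γ' k' m g le , p with Many-≈ₘ m (≈ₘ-sym p)
... | Γ'' , m' , g' = mkValueInv Γ'' k' m' (≈ᶜ-trans g g') le

value-++ : ∀ {Γ Δ v M N k h} → IsValue v → Γ ⊢[ k ] v ∶ M → Δ ⊢[ h ] v ∶ N →
           (Γ ⊎ᶜ Δ) ⊢[ k + h ] v ∶ (M ++ N)
value-++ {h = h} iv d e with value-inversion iv d
... | mkValueInv Γ' k' m g le = up (+-monoˡ-≤ h le) (convᶜ (⊎ᶜ-cong (≈ᶜ-sym g) ≈ᶜ-refl) (Many-++ m e))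
  where
  Many-++ : ∀ {Γ Δ v M N k h} → Many Γ v M k → Δ ⊢[ h ] v ∶ N → (Γ ⊎ᶜ Δ) ⊢[ k + h ] v ∶ (M ++ N)
  Many-++ (mnil _) e = e
  Many-++ (mcons {Γ = G} {Δ = D} {k = k₁} {h = k₂} d m) e =
    conv (≈ᶜ-sym (⊎ᶜ-assoc G D _)) (≈ₘ-refl _) (resize (≡.sym (+-assoc k₁ k₂ _)) (manyCons d (Many-++ m e)))

record ValueSplit (Γ : TCtx) (k : ℕ) (v : Term) (M₁ M₂ : MType) : Set where
  constructor mkValueSplit
  field
    Δ₁ Δ₂ : TCtx
    k₁ k₂ : ℕ
    d₁    : Δ₁ ⊢[ k₁ ] v ∶ M₁
    d₂    : Δ₂ ⊢[ k₂ ] v ∶ M₂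
    ctx   : Γ ≈ᶜ (Δ₁ ⊎ᶜ Δ₂)
    size  : k₁ + k₂ ≤ k

value-split : ∀ {Γ v M M₁ M₂ k} → IsValue v → Γ ⊢[ k ] v ∶ M → M ≈ₘ (M₁ ++ M₂) → ValueSplit Γ k v M₁ M₂
value-split {v = v} {M₁ = M₁} iv d p with value-inversion iv (conv ≈ᶜ-refl p d)
... | mkValueInv Γ' k' m g le with Many-split M₁ m
  where
  Many-split : ∀ {Γ M₂ k} M₁ → Many Γ v (M₁ ++ M₂) k → ValueSplit Γ k v M₁ M₂
  Many-split [] m = mkValueSplit emptyCtx _ 0 _ (manyNil iv) (Many⇒⊢ m) ≈ᶜ-refl ≤-refl
  Many-split (L ∷ M₁) (mcons {Γ = G} {k = k} d m) with Many-split M₁ m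
  ... | mkValueSplit Δ₁ Δ₂ k₁ k₂ d₁ d₂ ctx sz =
    mkValueSplit (G ⊎ᶜ Δ₁) Δ₂ (k + k₁) k₂ (manyCons d d₁) d₂
      (≈ᶜ-trans (⊎ᶜ-cong ≈ᶜ-refl ctx) (≈ᶜ-sym (⊎ᶜ-assoc G Δ₁ Δ₂)))
      (≤-trans (≤-reflexive (+-assoc k k₁ k₂)) (+-monoʳ-≤ k sz))
... | mkValueSplit Δ₁ Δ₂ k₁ k₂ d₁ d₂ ctx sz = mkValueSplit Δ₁ Δ₂ k₁ k₂ d₁ d₂ (≈ᶜ-trans g ctx) (≤-trans sz le)

value-[] : ∀ {Γ v M k} → IsValue v → Γ ⊢[ k ] v ∶ M → M ≈ₘ [] → Γ ≈ᶜ emptyCtx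
value-[] iv d p with value-inversion iv (conv ≈ᶜ-refl p d)
... | mkValueInv _ _ (mnil _) g _ = g

var-typing : ∀ x M → (x ↦ M) ⊢[ 0 ] var x ∶ M
var-typing x []      = convᶜ (↦-[] x) (manyNil (var x))
var-typing x (L ∷ M) = convᶜ (↦-⊎ᶜ x (L ∷ []) M) (manyCons (ax x L) (var-typing x M))

var-inversion : ∀ {Γ x M k} → Γ ⊢[ k ] var x ∶ M → Γ ≈ᶜ (x ↦ M)
var-inversion {x = x} d with value-inversion (var x) d
... | mkValueInv _ _ m g _ = ≈ᶜ-trans g (Many-var m)
  where
  Many-var : ∀ {Γ M k} → Many Γ (var x) M k → Γ ≈ᶜ (x ↦ M)
  Many-var (mnil _)           = ↦-[] x
  Many-var (mcons (ax .x L) m) = ≈ᶜ-trans (⊎ᶜ-cong ≈ᶜ-refl (Many-var m)) (↦-⊎ᶜ x (L ∷ []) _)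

record AppInv (Γ : TCtx) (k : ℕ) (t u : Term) (N : MType) : Set where
  constructor mkAppInv
  field
    Γ₁ Δ₁ : TCtx
    A     : MType
    k₁ k₂ : ℕ
    dt    : Γ₁ ⊢[ k₁ ] t ∶ ((A ⊸ N) ∷ [])
    du    : Δ₁ ⊢[ k₂ ] u ∶ A
    ctx   : Γ ≈ᶜ (Γ₁ ⊎ᶜ Δ₁)
    size  : suc (k₁ + k₂) ≤ k

app-inversion : ∀ {Γ k t u N} → Γ ⊢[ k ] app t u ∶ N → AppInv Γ k t u N
app-inversion (appT d e) = mkAppInv _ _ _ _ _ d e ≈ᶜ-refl ≤-refl
app-inversion (conv g p d) with app-inversion d
... | mkAppInv Γ₁ Δ₁ A k₁ k₂ dt du ctx sz =
  mkAppInv Γ₁ Δ₁ A k₁ k₂ (conv ≈ᶜ-refl (prep (arr (≈ₘ-refl A) p) []) dt) du (≈ᶜ-trans (≈ᶜ-sym g) ctx) sz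
app-inversion (up le d) with app-inversion d
... | mkAppInv Γ₁ Δ₁ A k₁ k₂ dt du ctx sz = mkAppInv Γ₁ Δ₁ A k₁ k₂ dt du ctx (≤-trans sz le)

record EsInv (Γ : TCtx) (k : ℕ) (t u : Term) (N : MType) : Set where
  constructor mkEsInv
  field
    Γ₁ Δ₁ : TCtx
    A     : MType
    k₁ k₂ : ℕ
    dt    : (Γ₁ ▸ A) ⊢[ k₁ ] t ∶ N
    du    : Δ₁ ⊢[ k₂ ] u ∶ A
    ctx   : Γ ≈ᶜ (Γ₁ ⊎ᶜ Δ₁)
    size  : suc (k₁ + k₂) ≤ k

es-inversion : ∀ {Γ k t u N} → Γ ⊢[ k ] es t u ∶ N → EsInv Γ k t u N
es-inversion (esT d e) = mkEsInv _ _ _ _ _ d e ≈ᶜ-refl ≤-refl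
es-inversion (conv g p d) with es-inversion d
... | mkEsInv Γ₁ Δ₁ A k₁ k₂ dt du ctx sz =
  mkEsInv Γ₁ Δ₁ A k₁ k₂ (conv ≈ᶜ-refl p dt) du (≈ᶜ-trans (≈ᶜ-sym g) ctx) sz
es-inversion (up le d) with es-inversion d
... | mkEsInv Γ₁ Δ₁ A k₁ k₂ dt du ctx sz = mkEsInv Γ₁ Δ₁ A k₁ k₂ dt du ctx (≤-trans sz le)

record LamInv (Γ : TCtx) (k : ℕ) (t : Term) (A N : MType) : Set where
  constructor mkLamInv
  field
    k₁   : ℕ
    body : (Γ ▸ A) ⊢[ k₁ ] t ∶ N
    size : suc k₁ ≤ k

lam-inversion : ∀ {Γ k t A N} → Γ ⊢[ k ] lam t ∶ ((A ⊸ N) ∷ []) → LamInv Γ k t A N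
lam-inversion {t = t} d with value-inversion (lam t) d
... | mkValueInv _ _ (mcons {Γ = G} {k = k₁} (abs b) (mnil _)) g le =
  mkLamInv _ (convᶜ (▸-cong (≈ᶜ-sym (≈ᶜ-trans g (⊎ᶜ-identityʳ G))) (≈ₘ-refl _)) b)
    (≤-trans (≤-reflexive (≡.sym (+-identityʳ k₁))) le)

pull-lift : ∀ R Γ M → pull (lift R) (Γ ▸ M) ≈ᶜ (pull R Γ ▸ M)
pull-lift R Γ M zero    = ≈ₘ-refl M
pull-lift R Γ M (suc x) = ≈ₘ-refl (Γ (ι R x))

rename-IsValue : ∀ ρ {v} → IsValue v → IsValue (rename ρ v)
rename-IsValue ρ (var x) = var (ρ x)
rename-IsValue ρ (lam t) = lam _

rename-typingₗ : ∀ R {Γ t L k} → Γ ⊢ₗ[ k ] t ∶ L →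
                 Σ TCtx λ Γ' → (Γ' ⊢ₗ[ k ] rename (ι R) t ∶ L) × (push R Γ ≈ᶜ Γ')
rename-typing  : ∀ R {Γ t M k} → Γ ⊢[ k ] t ∶ M → push R Γ ⊢[ k ] rename (ι R) t ∶ M
rename-typingₗ R (ax x L) = single (ι R x) L , ax (ι R x) L , push-↦ R x (L ∷ [])
rename-typingₗ R (abs {Γ = Γ} {M = M} d) =
  push R Γ , abs (convᶜ (pushWith-lift R [] Γ M) (rename-typing (lift R) d)) , ≈ᶜ-refl
rename-typing R (manyNil iv) = convᶜ (≈ᶜ-sym (push-empty R)) (manyNil (rename-IsValue (ι R) iv))
rename-typing R (manyCons {Γ = Γ} {Δ = Δ} d e) with rename-typingₗ R d
... | Γ' , d' , g = convᶜ (≈ᶜ-trans (⊎ᶜ-cong (≈ᶜ-sym g) ≈ᶜ-refl) (≈ᶜ-sym (push-⊎ᶜ R Γ Δ)))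
                          (manyCons d' (rename-typing R e))
rename-typing R (appT {Γ = Γ} {Δ = Δ} d e) =
  convᶜ (≈ᶜ-sym (push-⊎ᶜ R Γ Δ)) (appT (rename-typing R d) (rename-typing R e))
rename-typing R (esT {Γ = Γ} {Δ = Δ} {M = M} d e) =
  convᶜ (≈ᶜ-sym (push-⊎ᶜ R Γ Δ))
    (esT (convᶜ (pushWith-lift R [] Γ M) (rename-typing (lift R) d)) (rename-typing R e))
rename-typing R (conv g p d) = conv (push-cong R g) p (rename-typing R d)
rename-typing R (up le d)    = up le (rename-typing R d)

rename-typing⁻¹ : ∀ R t {Θ k M} → Θ ⊢[ k ] rename (ι R) t ∶ M →
                  (pull R Θ ⊢[ k ] t ∶ M) × (Θ ≈ᶜ push R (pull R Θ))
rename-typing⁻¹ R (var x) {M = M} d =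
  up z≤n (convᶜ (≈ᶜ-sym Θ∘ι≈) (var-typing x M)) ,
  ≈ᶜ-trans g (≈ᶜ-trans (≈ᶜ-sym (push-↦ R x M)) (push-cong R (≈ᶜ-sym Θ∘ι≈)))
  where
  g = var-inversion d
  Θ∘ι≈ : _ ≈ᶜ (x ↦ M)
  Θ∘ι≈ = ≈ᶜ-trans (λ y → g (ι R y)) (↦-ι R x M)
rename-typing⁻¹ R (lam t) d with value-inversion (lam _) d
... | mkValueInv Θ' k' m g le =
  up le (convᶜ (λ y → ≈ₘ-sym (g (ι R y))) (proj₁ (Many-rename⁻¹ m))) ,
  ≈ᶜ-trans g (≈ᶜ-trans (proj₂ (Many-rename⁻¹ m)) (push-cong R (λ y → ≈ₘ-sym (g (ι R y)))))
  where
  Many-rename⁻¹ : ∀ {Θ M k} → Many Θ (lam (rename (liftRen (ι R)) t)) M k →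
                  (pull R Θ ⊢[ k ] lam t ∶ M) × (Θ ≈ᶜ push R (pull R Θ))
  Many-rename⁻¹ (mnil _) = manyNil (lam t) , ≈ᶜ-sym (push-empty R)
  Many-rename⁻¹ (mcons {Γ = G} (abs {M = A} b) m) with rename-typing⁻¹ (lift R) t b | Many-rename⁻¹ m
  ... | b' , gb | m' , gm =
    manyCons (abs (convᶜ (pull-lift R G A) b')) m' ,
    ≈ᶜ-trans (⊎ᶜ-cong (λ y → trans (gb (suc y)) (≡⇒≈ₘ (push-lift-tail R _ y))) gm) (≈ᶜ-sym (push-⊎ᶜ R _ _))
rename-typing⁻¹ R (app t u) d with app-inversion d
... | mkAppInv Γ₁ Δ₁ A k₁ k₂ dt du ctx sz with rename-typing⁻¹ R t dt | rename-typing⁻¹ R u du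
... | dt' , g₁ | du' , g₂ =
  up sz (convᶜ (λ y → ≈ₘ-sym (ctx (ι R y))) (appT dt' du')) ,
  ≈ᶜ-trans ctx (≈ᶜ-trans (⊎ᶜ-cong g₁ g₂)
    (≈ᶜ-trans (≈ᶜ-sym (push-⊎ᶜ R _ _)) (push-cong R (λ y → ≈ₘ-sym (ctx (ι R y))))))
rename-typing⁻¹ R (es t u) d with es-inversion d
... | mkEsInv Γ₁ Δ₁ A k₁ k₂ dt du ctx sz with rename-typing⁻¹ (lift R) t dt | rename-typing⁻¹ R u du
... | dt' , g₁ | du' , g₂ =
  up sz (convᶜ (λ y → ≈ₘ-sym (ctx (ι R y))) (esT (convᶜ (pull-lift R Γ₁ A) dt') du')) ,
  ≈ᶜ-trans ctx (≈ᶜ-trans (⊎ᶜ-cong (λ y → trans (g₁ (suc y)) (≡⇒≈ₘ (push-lift-tail R _ y))) g₂)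
    (≈ᶜ-trans (≈ᶜ-sym (push-⊎ᶜ R _ _)) (push-cong R (λ y → ≈ₘ-sym (ctx (ι R y))))))

shift-typing : ∀ k {Γ t M h} → Γ ⊢[ h ] t ∶ M → push (weaken k) Γ ⊢[ h ] shift k t ∶ M
shift-typing k = rename-typing (weaken k)

shift-typing⁻¹ : ∀ k t {Θ h M} → Θ ⊢[ h ] shift k t ∶ M →
                 (pull (weaken k) Θ ⊢[ h ] t ∶ M) × (Θ ≈ᶜ push (weaken k) (pull (weaken k) Θ))
shift-typing⁻¹ k = rename-typing⁻¹ (weaken k)

shift1-typing : ∀ {Δ t M h} → Δ ⊢[ h ] t ∶ M → (Δ ▸ []) ⊢[ h ] shift 1 t ∶ M
shift1-typing {Δ} d = convᶜ (push-weaken-suc 0 Δ) (shift-typing 1 d)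

shift1-typing⁻¹ : ∀ t {Θ h M} → Θ ⊢[ h ] shift 1 t ∶ M → (tailᶜ Θ ⊢[ h ] t ∶ M) × (Θ zero ≈ₘ [])
shift1-typing⁻¹ t d with shift-typing⁻¹ 1 t d
... | d' , g = d' , g zero

+-interchange-≤ : ∀ a b c d h → c + d ≤ h → (a + c) + (b + d) ≤ (a + b) + h
+-interchange-≤ a b c d h le = ≤-trans (≤-reflexive (interchange a c b d)) (+-monoʳ-≤ (a + b) le)

▸-insert-remove : ∀ j Γ M {t N k} → (Γ ▸ M) ⊢[ k ] t ∶ N →
                  insert (suc j) (Γ j) (pull (skip j) Γ ▸ M) ⊢[ k ] t ∶ N
▸-insert-remove j Γ M =
  convᶜ (≈ᶜ-trans (▸-cong (insert-remove j Γ) (≈ₘ-refl M))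
                  (≈ᶜ-sym (pushWith-lift (skip j) (Γ j) (pull (skip j) Γ) M)))

▸-⊎ᶜ-push-weaken : ∀ j Γ M Δ → ((Γ ▸ M) ⊎ᶜ push (weaken (suc j)) Δ) ≈ᶜ ((Γ ⊎ᶜ push (weaken j) Δ) ▸ M)
▸-⊎ᶜ-push-weaken j Γ M Δ = ≈ᶜ-trans (⊎ᶜ-cong ≈ᶜ-refl (push-weaken-suc j Δ)) (▸-⊎ᶜ-[]ʳ Γ (push (weaken j) Δ) M)

insert-≈ᶜ-self : ∀ j {M Γ Θ} → insert j M Γ ≈ᶜ Θ → M ≈ₘ Θ j
insert-≈ᶜ-self j {M} {Γ} g = trans (≡⇒≈ₘ (≡.sym (insert-self j M Γ))) (g j)

insert-≈ᶜ-pull : ∀ j {M Γ Θ} → insert j M Γ ≈ᶜ Θ → Γ ≈ᶜ pull (skip j) Θ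
insert-≈ᶜ-pull j {M} {Γ} g x = trans (≡⇒≈ₘ (≡.sym (pushWith-ι (skip j) M Γ x))) (g (ι (skip j) x))

insert-⊎ᶜ-recombine : ∀ j {M Γ Γ₁ Γ₂ Δ Δ₁ Δ₂} → insert j M Γ ≈ᶜ (Γ₁ ⊎ᶜ Γ₂) → Δ ≈ᶜ (Δ₁ ⊎ᶜ Δ₂) →
  ((pull (skip j) Γ₁ ⊎ᶜ push (weaken j) Δ₁) ⊎ᶜ (pull (skip j) Γ₂ ⊎ᶜ push (weaken j) Δ₂))
    ≈ᶜ (Γ ⊎ᶜ push (weaken j) Δ)
insert-⊎ᶜ-recombine j {Γ₁ = Γ₁} {Γ₂} {Δ₁ = Δ₁} {Δ₂} g e =
  ≈ᶜ-trans (⊎ᶜ-interchange (pull (skip j) Γ₁) _ (pull (skip j) Γ₂) _)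
  (⊎ᶜ-cong (≈ᶜ-sym (insert-≈ᶜ-pull j g))
           (≈ᶜ-trans (≈ᶜ-sym (push-⊎ᶜ (weaken j) Δ₁ Δ₂)) (push-cong (weaken j) (≈ᶜ-sym e))))

subst-typing-var : ∀ j i {w Γ Δ M N k h} → IsValue w → insert j M Γ ⊢[ k ] var i ∶ N → Δ ⊢[ h ] w ∶ M →
                   (Γ ⊎ᶜ push (weaken j) Δ) ⊢[ k + h ] subst (j ≔ w) (var i) ∶ N
subst-typing-var j i {w} {Γ} {Δ} {M} {N} {k} {h} iv d dw with skip-view j i | var-inversion d
... | inj₁ refl | g =
  up (m≤n+m h k) (cast (≡.sym (≔-self j w)) (conv (⊎ᶜ-cong (≈ᶜ-sym Γ≈∅) ≈ᶜ-refl) M≈N (shift-typing j dw)))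
  where
  M≈N : M ≈ₘ N
  M≈N = trans (insert-≈ᶜ-self j g) (≡⇒≈ₘ (↦-self j N))
  Γ≈∅ : Γ ≈ᶜ emptyCtx
  Γ≈∅ x = trans (insert-≈ᶜ-pull j g x) (≡⇒≈ₘ (↦-other N (ι-skip-≢ j x)))
... | inj₂ (i' , refl) | g =
  up z≤n (cast (≡.sym (≔-skip j w i')) (convᶜ (≈ᶜ-sym ctx) (var-typing i' N)))
  where
  M≈[] : M ≈ₘ []
  M≈[] = trans (insert-≈ᶜ-self j g) (≡⇒≈ₘ (↦-other N (λ e → ι-skip-≢ j i' (≡.sym e))))
  ctx : (Γ ⊎ᶜ push (weaken j) Δ) ≈ᶜ (i' ↦ N)
  ctx = ≈ᶜ-trans (⊎ᶜ-cong (λ x → trans (insert-≈ᶜ-pull j g x) (↦-ι (skip j) i' N x))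
                          (≈ᶜ-trans (push-cong (weaken j) (value-[] iv dw M≈[])) (push-empty (weaken j))))
                 (⊎ᶜ-identityʳ _)

-- The substitution lemma: the typing of the value w is split among the
-- occurrences of the index j, as the multiset M dictates.
subst-typing : ∀ j t {w Γ Δ M N k h} → IsValue w → insert j M Γ ⊢[ k ] t ∶ N → Δ ⊢[ h ] w ∶ M →
               (Γ ⊎ᶜ push (weaken j) Δ) ⊢[ k + h ] subst (j ≔ w) t ∶ N
Many-subst-typing : ∀ j t {w Θ N k Δ h} → IsValue w → Many Θ (lam t) N k → Δ ⊢[ h ] w ∶ Θ j →
                    (pull (skip j) Θ ⊎ᶜ push (weaken j) Δ) ⊢[ k + h ] lam (subst (suc j ≔ w) t) ∶ N

subst-typing j (var i) iv d dw = subst-typing-var j i iv d dw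
subst-typing j (lam t) {h = h} iv d dw with value-inversion (lam t) d
... | mkValueInv Θ k' m g le =
  up (+-monoˡ-≤ h le)
     (convᶜ (⊎ᶜ-cong (≈ᶜ-sym (insert-≈ᶜ-pull j g)) ≈ᶜ-refl)
            (Many-subst-typing j t iv m (conv ≈ᶜ-refl (insert-≈ᶜ-self j g) dw)))
subst-typing j (app t u) {h = h} iv d dw with app-inversion d
... | mkAppInv Γ₁ Δ₁ A k₁ k₂ dt du g sz with value-split iv dw (insert-≈ᶜ-self j {Θ = Γ₁ ⊎ᶜ Δ₁} g)
... | mkValueSplit E₁ E₂ e₁ e₂ d₁ d₂ ctx sz' =
  up (≤-trans (s≤s (+-interchange-≤ k₁ k₂ e₁ e₂ h sz')) (+-monoˡ-≤ h sz))
     (convᶜ (insert-⊎ᶜ-recombine j {Γ₁ = Γ₁} {Δ₁} {Δ₁ = E₁} {E₂} g ctx)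
       (appT (subst-typing j t iv (convᶜ (insert-remove j Γ₁) dt) d₁)
             (subst-typing j u iv (convᶜ (insert-remove j Δ₁) du) d₂)))
subst-typing j (es t u) {h = h} iv d dw with es-inversion d
... | mkEsInv Γ₁ Δ₁ A k₁ k₂ dt du g sz with value-split iv dw (insert-≈ᶜ-self j {Θ = Γ₁ ⊎ᶜ Δ₁} g)
... | mkValueSplit E₁ E₂ e₁ e₂ d₁ d₂ ctx sz' =
  up (≤-trans (s≤s (+-interchange-≤ k₁ k₂ e₁ e₂ h sz')) (+-monoˡ-≤ h sz))
     (convᶜ (insert-⊎ᶜ-recombine j {Γ₁ = Γ₁} {Δ₁} {Δ₁ = E₁} {E₂} g ctx)
       (esT (convᶜ (▸-⊎ᶜ-push-weaken j (pull (skip j) Γ₁) A E₁)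
                   (subst-typing (suc j) t iv (▸-insert-remove j Γ₁ A dt) d₁))
            (subst-typing j u iv (convᶜ (insert-remove j Δ₁) du) d₂)))

Many-subst-typing j t iv (mnil _) dw =
  up z≤n (convᶜ (≈ᶜ-sym (≈ᶜ-trans (push-cong (weaken j) (value-[] iv dw [])) (push-empty (weaken j))))
                (manyNil (lam _)))
Many-subst-typing j t {h = h} iv (mcons {Γ = G} {Δ = D} {k = .(suc kb)} {h = h'} (abs {M = A} {k = kb} b) m) dw
  with value-split iv dw (≈ₘ-refl (G j ++ D j))
... | mkValueSplit E₁ E₂ e₁ e₂ d₁ d₂ ctx sz =
  up (+-interchange-≤ (suc kb) h' e₁ e₂ h sz)
     (convᶜ (insert-⊎ᶜ-recombine j {Γ₁ = G} {D} {Δ₁ = E₁} {E₂} (≈ᶜ-sym (insert-remove j (G ⊎ᶜ D))) ctx)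
       (manyCons (abs (convᶜ (▸-⊎ᶜ-push-weaken j (pull (skip j) G) A E₁)
                            (subst-typing (suc j) t iv (▸-insert-remove j G A b) d₁)))
                 (Many-subst-typing j t iv m d₂)))

record SubstInv (j : ℕ) (t w : Term) (Θ : TCtx) (N : MType) : Set where
  constructor mkSubstInv
  field
    Γ Δ : TCtx
    M   : MType
    dt  : insert j M Γ ⊢ˢ t ∶ N
    dw  : Δ ⊢ˢ w ∶ M
    ctx : Θ ≈ᶜ (Γ ⊎ᶜ push (weaken j) Δ)

⊎ᶜ-push-weaken-interchange : ∀ j {Θ₁ Θ₂ Γ₁ Γ₂ Δ₁ Δ₂} →
  Θ₁ ≈ᶜ (Γ₁ ⊎ᶜ push (weaken j) Δ₁) → Θ₂ ≈ᶜ (Γ₂ ⊎ᶜ push (weaken j) Δ₂) →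
  (Θ₁ ⊎ᶜ Θ₂) ≈ᶜ ((Γ₁ ⊎ᶜ Γ₂) ⊎ᶜ push (weaken j) (Δ₁ ⊎ᶜ Δ₂))
⊎ᶜ-push-weaken-interchange j {Γ₁ = Γ₁} {Γ₂} {Δ₁} {Δ₂} g₁ g₂ =
  ≈ᶜ-trans (⊎ᶜ-cong g₁ g₂)
  (≈ᶜ-trans (⊎ᶜ-interchange Γ₁ _ Γ₂ _) (⊎ᶜ-cong ≈ᶜ-refl (≈ᶜ-sym (push-⊎ᶜ (weaken j) Δ₁ Δ₂))))

insert-▸-split : ∀ j {Θ A Γ Δ M t N k} → (Θ ▸ A) ≈ᶜ (Γ ⊎ᶜ push (weaken (suc j)) Δ) →
                 insert (suc j) M Γ ⊢[ k ] t ∶ N →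
                 ((insert j M (tailᶜ Γ) ▸ A) ⊢[ k ] t ∶ N) × (Θ ≈ᶜ (tailᶜ Γ ⊎ᶜ push (weaken j) Δ))
insert-▸-split j {Γ = Γ} {M = M} g d =
  convᶜ (≈ᶜ-trans (pushWith-cong (skip (suc j)) (≈ₘ-refl M) (▸-η Γ))
        (≈ᶜ-trans (pushWith-lift (skip j) M (tailᶜ Γ) (Γ zero))
                  (▸-cong ≈ᶜ-refl (≈ₘ-sym (trans (g zero) (≡⇒≈ₘ (++-identityʳ (Γ zero)))))))) d ,
  (λ y → g (suc y))

subst-typing⁻¹ : ∀ j t {w Θ N k} → IsValue w → Θ ⊢[ k ] subst (j ≔ w) t ∶ N → SubstInv j t w Θ N
Many-subst-typing⁻¹ : ∀ j t {w Θ N k} → IsValue w → Many Θ (lam (subst (suc j ≔ w) t)) N k →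
                      SubstInv j (lam t) w Θ N

subst-typing⁻¹ j (var i) {w} {Θ} {N} iv d with skip-view j i
... | inj₁ refl with shift-typing⁻¹ j w (cast (≔-self j w) d)
...   | dw , g = mkSubstInv emptyCtx _ N (0 , convᶜ (≈ᶜ-sym (insert-↦ j N)) (var-typing j N)) (_ , dw) g
subst-typing⁻¹ j (var i) {w} {Θ} iv d | inj₂ (i' , refl) =
  mkSubstInv Θ emptyCtx [] (_ , rename-typing (skip j) (cast (≔-skip j w i') d)) (0 , manyNil iv)
    (≈ᶜ-sym (≈ᶜ-trans (⊎ᶜ-cong ≈ᶜ-refl (push-empty (weaken j))) (⊎ᶜ-identityʳ Θ)))
subst-typing⁻¹ j (lam t) iv d with value-inversion (lam _) d
... | mkValueInv _ _ m g _ with Many-subst-typing⁻¹ j t iv m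
... | mkSubstInv Γ Δ M dt dw ctx = mkSubstInv Γ Δ M dt dw (≈ᶜ-trans g ctx)
subst-typing⁻¹ j (app t u) iv d with app-inversion d
... | mkAppInv Γ₁ Δ₁ A k₁ k₂ dt du g sz with subst-typing⁻¹ j t iv dt | subst-typing⁻¹ j u iv du
... | mkSubstInv Γa Δa Ma (_ , da) (_ , dwa) ga | mkSubstInv Γb Δb Mb (_ , db) (_ , dwb) gb =
  mkSubstInv (Γa ⊎ᶜ Γb) (Δa ⊎ᶜ Δb) (Ma ++ Mb)
    (_ , convᶜ (≈ᶜ-sym (pushWith-⊎ᶜ (skip j) Ma Mb Γa Γb)) (appT da db))
    (_ , value-++ iv dwa dwb) (≈ᶜ-trans g (⊎ᶜ-push-weaken-interchange j ga gb))
subst-typing⁻¹ j (es t u) iv d with es-inversion d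
... | mkEsInv Γ₁ Δ₁ A k₁ k₂ dt du g sz with subst-typing⁻¹ (suc j) t iv dt | subst-typing⁻¹ j u iv du
... | mkSubstInv Γa Δa Ma (_ , da) (_ , dwa) ga | mkSubstInv Γb Δb Mb (_ , db) (_ , dwb) gb
  with insert-▸-split j ga da
... | da' , ga' =
  mkSubstInv (tailᶜ Γa ⊎ᶜ Γb) (Δa ⊎ᶜ Δb) (Ma ++ Mb)
    (_ , convᶜ (≈ᶜ-sym (pushWith-⊎ᶜ (skip j) Ma Mb _ Γb)) (esT da' db))
    (_ , value-++ iv dwa dwb) (≈ᶜ-trans g (⊎ᶜ-push-weaken-interchange j ga' gb))

Many-subst-typing⁻¹ j t iv (mnil _) =
  mkSubstInv emptyCtx emptyCtx [] (0 , convᶜ (≈ᶜ-sym (push-empty (skip j))) (manyNil (lam t))) (0 , manyNil iv)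
    (≈ᶜ-sym (push-empty (weaken j)))
Many-subst-typing⁻¹ j t iv (mcons (abs b) m) with subst-typing⁻¹ (suc j) t iv b | Many-subst-typing⁻¹ j t iv m
... | mkSubstInv Γb Δb Mb (_ , db) (_ , dwb) gb | mkSubstInv Γm Δm Mm (_ , dm) (_ , dwm) gm
  with insert-▸-split j gb db
... | db' , gb' =
  mkSubstInv (tailᶜ Γb ⊎ᶜ Γm) (Δb ⊎ᶜ Δm) (Mb ++ Mm)
    (_ , convᶜ (≈ᶜ-sym (pushWith-⊎ᶜ (skip j) Mb Mm _ Γm)) (manyCons (abs db') dm))
    (_ , value-++ iv dwb dwm)
    (⊎ᶜ-push-weaken-interchange j gb' gm)

-- SCtxTyping Γ L Γ' s: the substitutions of L are typed (with total size s)
-- so that a term typed in Γ' gets, once plugged into L, the context Γ.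
data SCtxTyping : TCtx → SCtx → TCtx → ℕ → Set where
  nil  : ∀ {Γ Γ'} → Γ ≈ᶜ Γ' → SCtxTyping Γ [] Γ' 0
  cons : ∀ {Γ Γ₁ Θ Δ u M L Γ' h s} → Δ ⊢[ h ] u ∶ M → SCtxTyping Θ L Γ' s →
         Θ ≈ᶜ (Γ₁ ▸ M) → Γ ≈ᶜ (Γ₁ ⊎ᶜ Δ) → SCtxTyping Γ (u ∷ L) Γ' (suc (s + h))

plug-typing : ∀ {Γ L Γ' s r A k} → SCtxTyping Γ L Γ' s → Γ' ⊢[ k ] r ∶ A → Γ ⊢[ s + k ] plug L r ∶ A
plug-typing (nil g) d = convᶜ (≈ᶜ-sym g) d
plug-typing {k = k} (cons {h = h} {s = s} du ℓ g₁ g₂) d =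
  resize (≡.cong suc (xy∙z≈xz∙y s k h)) (convᶜ (≈ᶜ-sym g₂) (esT (convᶜ g₁ (plug-typing ℓ d)) du))

record PlugInv (Γ : TCtx) (k : ℕ) (L : SCtx) (r : Term) (A : MType) : Set where
  constructor mkPlugInv
  field
    Γ'    : TCtx
    s k'  : ℕ
    frame : SCtxTyping Γ L Γ' s
    dr    : Γ' ⊢[ k' ] r ∶ A
    size  : s + k' ≤ k

plug-inversion : ∀ L {Γ k r A} → Γ ⊢[ k ] plug L r ∶ A → PlugInv Γ k L r A
plug-inversion []      {Γ} {k} d = mkPlugInv Γ 0 k (nil ≈ᶜ-refl) d ≤-refl
plug-inversion (u ∷ L) d with es-inversion d
... | mkEsInv Γ₁ Δ₁ A k₁ k₂ dt du ctx sz with plug-inversion L dt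
... | mkPlugInv Γ' s k' ℓ dr sz' =
  mkPlugInv Γ' (suc (s + k₂)) k' (cons du ℓ ≈ᶜ-refl ctx) dr
    (≤-trans (s≤s (≤-trans (≤-reflexive (xy∙z≈xz∙y s k₂ k')) (+-monoˡ-≤ k₂ sz'))) sz)

SCtxTyping-≈ᶜ : ∀ {Γ L Γ' Γ'' s} → Γ' ≈ᶜ Γ'' → SCtxTyping Γ L Γ' s → SCtxTyping Γ L Γ'' s
SCtxTyping-≈ᶜ e (nil g)           = nil (≈ᶜ-trans g e)
SCtxTyping-≈ᶜ e (cons d ℓ g₁ g₂) = cons d (SCtxTyping-≈ᶜ e ℓ) g₁ g₂

SCtxTyping-extend : ∀ {Γ L Γ' s} → SCtxTyping Γ L Γ' s → ∀ Δ →
                    SCtxTyping (Γ ⊎ᶜ Δ) L (Γ' ⊎ᶜ push (weaken (length L)) Δ) s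
SCtxTyping-extend (nil g) Δ = nil (⊎ᶜ-cong g ≈ᶜ-refl)
SCtxTyping-extend {L = u ∷ L} (cons {Γ₁ = Γ₁} {Δ = Du} {M = M} d ℓ g₁ g₂) Δ =
  cons d (SCtxTyping-≈ᶜ (⊎ᶜ-cong ≈ᶜ-refl (push-weaken-▸ (length L) Δ)) (SCtxTyping-extend ℓ (Δ ▸ [])))
       (≈ᶜ-trans (⊎ᶜ-cong g₁ ≈ᶜ-refl) (▸-⊎ᶜ-[]ʳ Γ₁ Δ M))
       (≈ᶜ-trans (⊎ᶜ-cong g₂ ≈ᶜ-refl) (⊎ᶜ-swapʳ Γ₁ Du Δ))

SCtxTyping-subtract : ∀ {Γ L Γ' Γ₁ Δ s} → SCtxTyping Γ L Γ' s → Γ' ≈ᶜ (Γ₁ ⊎ᶜ push (weaken (length L)) Δ) →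
                      Σ TCtx λ Γ₀ → SCtxTyping Γ₀ L Γ₁ s × (Γ ≈ᶜ (Γ₀ ⊎ᶜ Δ))
SCtxTyping-subtract {Γ₁ = Γ₁} (nil g) e = Γ₁ , nil ≈ᶜ-refl , ≈ᶜ-trans g e
SCtxTyping-subtract {L = u ∷ L} {Δ = Δ} (cons {Δ = Du} {M = M} d ℓ g₁ g₂) e
  with SCtxTyping-subtract {Δ = Δ ▸ []} ℓ (≈ᶜ-trans e (⊎ᶜ-cong ≈ᶜ-refl (≈ᶜ-sym (push-weaken-▸ (length L) Δ))))
... | Γ₀ , ℓ' , g =
  (tailᶜ Γ₀ ⊎ᶜ Du) ,
  cons d ℓ' (≈ᶜ-trans (▸-η Γ₀) (▸-cong ≈ᶜ-refl head≈)) ≈ᶜ-refl ,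
  ≈ᶜ-trans g₂ (≈ᶜ-trans (⊎ᶜ-cong (λ y → trans (≈ₘ-sym (g₁ (suc y))) (g (suc y))) ≈ᶜ-refl) (⊎ᶜ-swapʳ _ Δ Du))
  where
  head≈ : Γ₀ zero ≈ₘ M
  head≈ = ≈ₘ-sym (trans (≈ₘ-sym (g₁ zero)) (trans (g zero) (≡⇒≈ₘ (++-identityʳ (Γ₀ zero)))))

substUnder-typing : ∀ n {Γ A t N k Δ v h} → IsValue v → (Γ ▸ A) ⊢[ k ] t ∶ N → Δ ⊢[ h ] v ∶ A →
                    (push (weaken n) Γ ⊎ᶜ Δ) ⊢[ k + h ] substUnder n v t ∶ N
substUnder-typing n {Γ} {A} {t} {v = v} iv dt dv =
  cast (≡.sym (substUnder-≔ n v t))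
    (subst-typing 0 (rename (liftRen (n +_)) t) iv
      (convᶜ (≈ᶜ-trans (pushWith-lift (weaken n) [] Γ A) (▸-insert-0 A _)) (rename-typing (lift (weaken n)) dt))
      dv)

substUnder-typing⁻¹ : ∀ n t {v Θ N k} → IsValue v → Θ ⊢[ k ] substUnder n v t ∶ N →
                      Σ TCtx λ Γ → Σ TCtx λ Δ → Σ MType λ A →
                      (Γ ▸ A) ⊢ˢ t ∶ N × Δ ⊢ˢ v ∶ A × (Θ ≈ᶜ (push (weaken n) Γ ⊎ᶜ Δ))
substUnder-typing⁻¹ n t {v} iv d
  with subst-typing⁻¹ 0 (rename (liftRen (n +_)) t) iv (cast (substUnder-≔ n v t) d)
... | mkSubstInv Γ Δ A (_ , dr) dv ctx
  with rename-typing⁻¹ (lift (weaken n)) t (convᶜ (≈ᶜ-sym (▸-insert-0 A Γ)) dr)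
... | dt , g =
  pull (weaken n) Γ , Δ , A , (_ , convᶜ (pull-lift (weaken n) Γ A) dt) , dv ,
  ≈ᶜ-trans ctx (⊎ᶜ-cong (λ y → trans (g (suc y)) (≡⇒≈ₘ (push-lift-tail (weaken n) _ y))) ≈ᶜ-refl)

β-frame : ∀ L {Γ Δ t u A N k h} → Γ ⊢[ k ] plug L (lam t) ∶ ((A ⊸ N) ∷ []) → Δ ⊢[ h ] u ∶ A →
          PlugInv (Γ ⊎ᶜ Δ) (k + h) L (es t (shift (length L) u)) N
β-frame L {Δ = Δ} {h = h} dt du with plug-inversion L dt
... | mkPlugInv Γ' s k' ℓ dr sz with lam-inversion dr
... | mkLamInv kb body sz' =
  mkPlugInv _ s _ (SCtxTyping-extend ℓ Δ) (esT body (shift-typing (length L) du))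
    (≤-trans (≤-reflexive (≡.sym (+-assoc s (suc kb) h))) (+-monoˡ-≤ h (≤-trans (+-monoʳ-≤ s sz') sz)))

es-value-frame : ∀ L {Γ Δ t v A N k h} → IsValue v → (Γ ▸ A) ⊢[ k ] t ∶ N → Δ ⊢[ h ] plug L v ∶ A →
                 PlugInv (Δ ⊎ᶜ Γ) (k + h) L (substUnder (length L) v t) N
es-value-frame L {Γ} {k = k} iv dt dv with plug-inversion L dv
... | mkPlugInv Δ' s k' ℓ dr sz =
  mkPlugInv _ s _ (SCtxTyping-≈ᶜ (⊎ᶜ-comm Δ' _) (SCtxTyping-extend ℓ Γ)) (substUnder-typing (length L) iv dt dr)
    (≤-trans (≤-reflexive (x∙yz≈y∙xz s k k')) (+-monoʳ-≤ k sz))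

plug-app-typing : ∀ {Γ Δ I h f A N k₁ k₂} → Γ ⊢[ k₁ ] plug I h ∶ ((A ⊸ N) ∷ []) → Δ ⊢[ k₂ ] f ∶ A →
                  (Γ ⊎ᶜ Δ) ⊢[ suc (k₁ + k₂) ] plug I (app h (shift (length I) f)) ∶ N
plug-app-typing {Δ = Δ} {I = I} {k₂ = k₂} dh df with plug-inversion I dh
... | mkPlugInv Γ' s k' ℓ dr sz =
  up (≤-trans (≤-reflexive (≡.trans (+-suc s (k' + k₂)) (≡.cong suc (≡.sym (+-assoc s k' k₂)))))
              (s≤s (+-monoˡ-≤ k₂ sz)))
     (plug-typing (SCtxTyping-extend ℓ Δ) (appT dr (shift-typing (length I) df)))

⟶-shrinks-typing : ∀ {t s Γ M k} → t ⟶ s → Γ ⊢[ k ] t ∶ M → Σ ℕ λ k' → k' < k × Γ ⊢[ k' ] s ∶ M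
⟶-shrinks-typing (rootM L t u) d with app-inversion d
... | mkAppInv Γ₁ Δ₁ A k₁ k₂ dt du ctx sz with β-frame L dt du
... | mkPlugInv Γ' s k' ℓ dr sz' = _ , ≤-trans (s≤s sz') sz , convᶜ (≈ᶜ-sym ctx) (plug-typing ℓ dr)
⟶-shrinks-typing (rootE L t v iv) d with es-inversion d
... | mkEsInv Γ₁ Δ₁ A k₁ k₂ dt du ctx sz with es-value-frame L iv dt du
... | mkPlugInv Γ' s k' ℓ dr sz' =
  _ , ≤-trans (s≤s sz') sz , convᶜ (≈ᶜ-sym (≈ᶜ-trans ctx (⊎ᶜ-comm Γ₁ Δ₁))) (plug-typing ℓ dr)
⟶-shrinks-typing (appL u st) d with app-inversion d
... | mkAppInv Γ₁ Δ₁ A k₁ k₂ dt du ctx sz with ⟶-shrinks-typing st dt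
... | _ , lt , dt' = _ , ≤-trans (s≤s (+-monoˡ-≤ k₂ lt)) sz , convᶜ (≈ᶜ-sym ctx) (appT dt' du)
⟶-shrinks-typing (appR t st) d with app-inversion d
... | mkAppInv Γ₁ Δ₁ A k₁ k₂ dt du ctx sz with ⟶-shrinks-typing st du
... | k₂' , lt , du' =
  _ , ≤-trans (s≤s (≤-trans (≤-reflexive (≡.sym (+-suc k₁ k₂'))) (+-monoʳ-≤ k₁ lt))) sz ,
  convᶜ (≈ᶜ-sym ctx) (appT dt du')
⟶-shrinks-typing (esL u st) d with es-inversion d
... | mkEsInv Γ₁ Δ₁ A k₁ k₂ dt du ctx sz with ⟶-shrinks-typing st dt
... | _ , lt , dt' = _ , ≤-trans (s≤s (+-monoˡ-≤ k₂ lt)) sz , convᶜ (≈ᶜ-sym ctx) (esT dt' du)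
⟶-shrinks-typing (esR t st) d with es-inversion d
... | mkEsInv Γ₁ Δ₁ A k₁ k₂ dt du ctx sz with ⟶-shrinks-typing st du
... | k₂' , lt , du' =
  _ , ≤-trans (s≤s (≤-trans (≤-reflexive (≡.sym (+-suc k₁ k₂'))) (+-monoʳ-≤ k₁ lt))) sz ,
  convᶜ (≈ᶜ-sym ctx) (esT dt du')

LamAnswer : Term → Set
LamAnswer a = Σ SCtx λ L → Σ Term λ t → a ≡ plug L (lam t)

ValueAnswer : Term → Set
ValueAnswer b = Σ SCtx λ L → Σ Term λ v → IsValue v × b ≡ plug L v

es-injectiveˡ : ∀ {a b c d} → Term.es a b ≡ Term.es c d → a ≡ c
es-injectiveˡ refl = refl

lamAnswer? : ∀ a → Dec (LamAnswer a)
lamAnswer? (var x)   = no λ { ([] , _ , ()) ; (_ ∷ _ , _ , ()) }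
lamAnswer? (lam t)   = yes ([] , t , refl)
lamAnswer? (app a b) = no λ { ([] , _ , ()) ; (_ ∷ _ , _ , ()) }
lamAnswer? (es a u) with lamAnswer? a
... | yes (L , t , e) = yes (u ∷ L , t , ≡.cong (λ z → es z u) e)
... | no ¬p = no λ { ([] , _ , ()) ; (_ ∷ L , t , e) → ¬p (L , t , es-injectiveˡ e) }

valueAnswer? : ∀ b → Dec (ValueAnswer b)
valueAnswer? (var x)   = yes ([] , var x , var x , refl)
valueAnswer? (lam t)   = yes ([] , lam t , lam t , refl)
valueAnswer? (app a b) = no λ { ([] , _ , () , refl) ; (_ ∷ _ , _ , _ , ()) }
valueAnswer? (es a u) with valueAnswer? a
... | yes (L , v , iv , e) = yes (u ∷ L , v , iv , ≡.cong (λ z → es z u) e)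
... | no ¬p = no λ { ([] , _ , () , refl) ; (_ ∷ L , v , iv , e) → ¬p (L , v , iv , es-injectiveˡ e) }

app-Normal : ∀ {a b} → Normal a → Normal b → ¬ LamAnswer a → Normal (app a b)
app-Normal na nb ¬l _ (rootM L t u) = ¬l (L , t , refl)
app-Normal na nb ¬l _ (appL u st)   = na _ st
app-Normal na nb ¬l _ (appR t st)   = nb _ st

es-Normal : ∀ {a b} → Normal a → Normal b → ¬ ValueAnswer b → Normal (es a b)
es-Normal na nb ¬v _ (rootE L t v iv) = ¬v (L , v , iv , refl)
es-Normal na nb ¬v _ (esL u st)       = na _ st
es-Normal na nb ¬v _ (esR t st)       = nb _ st

progress : ∀ t → (Σ Term λ s → t ⟶ s) ⊎ Normal t
progress (var x) = inj₂ λ _ ()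
progress (lam t) = inj₂ λ _ ()
progress (app a b) with progress a | progress b
... | inj₁ (_ , st) | _             = inj₁ (_ , appL b st)
... | inj₂ _        | inj₁ (_ , st) = inj₁ (_ , appR a st)
... | inj₂ na       | inj₂ nb with lamAnswer? a
...   | yes (L , t , refl) = inj₁ (_ , rootM L t b)
...   | no ¬l              = inj₂ (app-Normal na nb ¬l)
progress (es a b) with progress a | progress b
... | inj₁ (_ , st) | _             = inj₁ (_ , esL b st)
... | inj₂ _        | inj₁ (_ , st) = inj₁ (_ , esR a st)
... | inj₂ na       | inj₂ nb with valueAnswer? b
...   | yes (L , v , iv , refl) = inj₁ (_ , rootE L a v iv)
...   | no ¬v                   = inj₂ (es-Normal na nb ¬v)

typable⇒HasNF : ∀ {Γ t M k} → Γ ⊢[ k ] t ∶ M → HasNF t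
typable⇒HasNF {k = k} = go (suc k) ≤-refl
  where
  go : ∀ n {Γ t M k} → k < n → Γ ⊢[ k ] t ∶ M → HasNF t
  go (suc n) {t = t} lt d with progress t
  ... | inj₂ nt = t , ε , nt
  ... | inj₁ (s , st) with ⟶-shrinks-typing st d
  ... | _ , lt' , d' with go n (≤-trans lt' (≤-pred lt)) d'
  ... | m , red , nm = m , st ◅ red , nm

⇓-preserves-typing : ∀ {t n f Γ M k} → t ⇓[ n ] f → Γ ⊢[ k ] t ∶ M → Γ ⊢[ k ] f ∶ M
⇓-preserves-typing (val iv) d = d
⇓-preserves-typing (appβ {I = I} _ td sd) d with app-inversion d
... | mkAppInv Γ₁ Δ₁ A k₁ k₂ dt du ctx sz with β-frame I (⇓-preserves-typing td dt) du
... | mkPlugInv Γ' s k' ℓ dr sz' =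
  up (≤-trans sz' (≤-trans (n≤1+n _) sz)) (convᶜ (≈ᶜ-sym ctx) (plug-typing ℓ (⇓-preserves-typing sd dr)))
⇓-preserves-typing (appVar _ td ud) d with app-inversion d
... | mkAppInv Γ₁ Δ₁ A k₁ k₂ dt du ctx sz =
  up sz (convᶜ (≈ᶜ-sym ctx) (plug-app-typing (⇓-preserves-typing td dt) (⇓-preserves-typing ud du)))
⇓-preserves-typing (appIn _ _ td ud) d with app-inversion d
... | mkAppInv Γ₁ Δ₁ A k₁ k₂ dt du ctx sz =
  up sz (convᶜ (≈ᶜ-sym ctx) (plug-app-typing (⇓-preserves-typing td dt) (⇓-preserves-typing ud du)))
⇓-preserves-typing (esVal {I = I} _ iv ud td) d with es-inversion d
... | mkEsInv Γ₁ Δ₁ A k₁ k₂ dt du ctx sz with es-value-frame I iv dt (⇓-preserves-typing ud du)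
... | mkPlugInv Γ' s k' ℓ dr sz' =
  up (≤-trans sz' (≤-trans (n≤1+n _) sz))
     (convᶜ (≈ᶜ-sym (≈ᶜ-trans ctx (⊎ᶜ-comm Γ₁ Δ₁))) (plug-typing ℓ (⇓-preserves-typing td dr)))
⇓-preserves-typing (esIn _ td ud) d with es-inversion d
... | mkEsInv Γ₁ Δ₁ A k₁ k₂ dt du ctx sz =
  up sz (convᶜ (≈ᶜ-sym ctx) (esT (⇓-preserves-typing td dt) (⇓-preserves-typing ud du)))

SCtxTyping-unshift : ∀ {Γ L Γ' Γ₁ Θ u M s h} → SCtxTyping Γ L Γ' s → Γ' ≈ᶜ (Γ₁ ⊎ᶜ Θ) →
                     Θ ⊢[ h ] shift (length L) u ∶ M →
                     Σ TCtx λ Γ₀ → SCtxTyping Γ₀ L Γ₁ s × (pull (weaken (length L)) Θ ⊢[ h ] u ∶ M)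
                                   × (Γ ≈ᶜ (Γ₀ ⊎ᶜ pull (weaken (length L)) Θ))
SCtxTyping-unshift {L = L} {u = u} ℓ g du with shift-typing⁻¹ (length L) u du
... | du' , gu with SCtxTyping-subtract ℓ (≈ᶜ-trans g (⊎ᶜ-cong ≈ᶜ-refl gu))
... | Γ₀ , ℓ' , g' = Γ₀ , ℓ' , du' , g'

plug-app-typing⁻¹ : ∀ {Γ I h f N k} → Γ ⊢[ k ] plug I (app h (shift (length I) f)) ∶ N →
                    Σ TCtx λ Γ₁ → Σ TCtx λ Δ → Σ MType λ A →
                    Γ₁ ⊢ˢ plug I h ∶ ((A ⊸ N) ∷ []) × Δ ⊢ˢ f ∶ A × (Γ ≈ᶜ (Γ₁ ⊎ᶜ Δ))
plug-app-typing⁻¹ {I = I} d with plug-inversion I d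
... | mkPlugInv Γ' s k' ℓ dr sz with app-inversion dr
... | mkAppInv Γh Δf A k₁ k₂ dh df ctx sz' with SCtxTyping-unshift ℓ ctx df
... | Γ₀ , ℓ' , df' , g = Γ₀ , _ , A , (_ , plug-typing ℓ' dh) , (_ , df') , g

⇓-reflects-typing : ∀ {t n f Γ M k} → t ⇓[ n ] f → Γ ⊢[ k ] f ∶ M → Γ ⊢ˢ t ∶ M
⇓-reflects-typing (val iv) d = _ , d
⇓-reflects-typing (appβ {I = I} _ td sd) d with plug-inversion I d
... | mkPlugInv Γ' s k' ℓ df sz with ⇓-reflects-typing sd df
... | _ , de with es-inversion de
... | mkEsInv Γs Δs A k₁ k₂ dt ds ctx sz' with SCtxTyping-unshift ℓ ctx ds
... | Γ₀ , ℓ' , du , g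
  with ⇓-reflects-typing td (plug-typing ℓ' (convᶜ (⊎ᶜ-identityʳ Γs) (manyCons (abs dt) (manyNil (lam _)))))
... | _ , dt' = _ , convᶜ (≈ᶜ-sym g) (appT dt' du)
⇓-reflects-typing (appVar _ td ud) d with plug-app-typing⁻¹ d
... | Γ₁ , Δ , A , (_ , dh) , (_ , df) , g with ⇓-reflects-typing td dh | ⇓-reflects-typing ud df
... | _ , dt | _ , du = _ , convᶜ (≈ᶜ-sym g) (appT dt du)
⇓-reflects-typing (appIn _ _ td ud) d with plug-app-typing⁻¹ d
... | Γ₁ , Δ , A , (_ , dh) , (_ , df) , g with ⇓-reflects-typing td dh | ⇓-reflects-typing ud df
... | _ , dt | _ , du = _ , convᶜ (≈ᶜ-sym g) (appT dt du)
⇓-reflects-typing (esVal {t = t} {I = I} _ iv ud td) d with plug-inversion I d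
... | mkPlugInv Γ' s k' ℓ df sz with ⇓-reflects-typing td df
... | _ , dsu with substUnder-typing⁻¹ (length I) t iv dsu
... | Γ₁ , Δ , A , (_ , dt) , (_ , dv) , ctx
  with SCtxTyping-subtract ℓ (≈ᶜ-trans ctx (⊎ᶜ-comm _ Δ))
... | Γ₀ , ℓ' , g with ⇓-reflects-typing ud (plug-typing ℓ' dv)
... | _ , du = _ , convᶜ (≈ᶜ-sym (≈ᶜ-trans g (⊎ᶜ-comm Γ₀ Γ₁))) (esT dt du)
⇓-reflects-typing (esIn _ td ud) d with es-inversion d
... | mkEsInv Γ₁ Δ₁ A k₁ k₂ dt du ctx sz with ⇓-reflects-typing td dt | ⇓-reflects-typing ud du
... | _ , dt' | _ , du' = _ , convᶜ (≈ᶜ-sym ctx) (esT dt' du')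

infix 4 _≾ˢ_

_≾ˢ_ : Term → Term → Set
t ≾ˢ t' = ∀ {Γ M k} → Γ ⊢[ k ] t ∶ M → Γ ⊢ˢ t' ∶ M

≾ˢ-trans : ∀ {t t' t''} → t ≾ˢ t' → t' ≾ˢ t'' → t ≾ˢ t''
≾ˢ-trans f g d = g (proj₂ (f d))

▸-split-⊎ᶜˡ : ∀ {Γ A Θ₁ Θ₂} → (Γ ▸ A) ≈ᶜ (Θ₁ ⊎ᶜ Θ₂) → Θ₂ zero ≈ₘ [] →
              (Θ₁ ≈ᶜ (tailᶜ Θ₁ ▸ A)) × (Γ ≈ᶜ (tailᶜ Θ₁ ⊎ᶜ tailᶜ Θ₂))
▸-split-⊎ᶜˡ {Θ₁ = Θ₁} g z =
  ≈ᶜ-trans (▸-η Θ₁) (▸-cong ≈ᶜ-refl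
    (≈ₘ-sym (trans (g zero) (trans (++-congₘ (≈ₘ-refl (Θ₁ zero)) z) (≡⇒≈ₘ (++-identityʳ (Θ₁ zero))))))) ,
  (λ y → g (suc y))

▸-split-⊎ᶜʳ : ∀ {Γ A Θ₁ Θ₂} → (Γ ▸ A) ≈ᶜ (Θ₁ ⊎ᶜ Θ₂) → Θ₁ zero ≈ₘ [] →
              (Θ₂ ≈ᶜ (tailᶜ Θ₂ ▸ A)) × (Γ ≈ᶜ (tailᶜ Θ₁ ⊎ᶜ tailᶜ Θ₂))
▸-split-⊎ᶜʳ {Θ₂ = Θ₂} g z =
  ≈ᶜ-trans (▸-η Θ₂) (▸-cong ≈ᶜ-refl (≈ₘ-sym (trans (g zero) (++-congₘ z (≈ₘ-refl (Θ₂ zero)))))) ,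
  (λ y → g (suc y))

axL-≾ˢ : ∀ t s u → es (app t (shift 1 s)) u ≾ˢ app (es t u) s
axL-≾ˢ t s u d with es-inversion d
... | mkEsInv Γ₁ Δ A _ _ d₁ du ctx _ with app-inversion d₁
... | mkAppInv Θ₁ Θ₂ B _ _ dt ds g _ with shift1-typing⁻¹ s ds
... | ds' , z with ▸-split-⊎ᶜˡ g z
... | h₁ , h₂ =
  _ , convᶜ (≈ᶜ-sym (≈ᶜ-trans ctx (≈ᶜ-trans (⊎ᶜ-cong h₂ ≈ᶜ-refl) (⊎ᶜ-swapʳ (tailᶜ Θ₁) (tailᶜ Θ₂) Δ))))
            (appT (esT (convᶜ h₁ dt) du) ds')

axL-≿ˢ : ∀ t s u → app (es t u) s ≾ˢ es (app t (shift 1 s)) u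
axL-≿ˢ t s u d with app-inversion d
... | mkAppInv Γ₁ Δs B _ _ d₁ ds ctx _ with es-inversion d₁
... | mkEsInv Θ₁ Θ₂ A _ _ dt du g _ =
  _ , convᶜ (≈ᶜ-sym (≈ᶜ-trans ctx (≈ᶜ-trans (⊎ᶜ-cong g ≈ᶜ-refl) (⊎ᶜ-swapʳ Θ₁ Θ₂ Δs))))
            (esT (convᶜ (▸-⊎ᶜ-[]ʳ Θ₁ Δs A) (appT dt (shift1-typing ds))) du)

axR-≾ˢ : ∀ t s u → es (app (shift 1 t) s) u ≾ˢ app t (es s u)
axR-≾ˢ t s u d with es-inversion d
... | mkEsInv Γ₁ Δ A _ _ d₁ du ctx _ with app-inversion d₁
... | mkAppInv Θ₁ Θ₂ B _ _ dt ds g _ with shift1-typing⁻¹ t dt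
... | dt' , z with ▸-split-⊎ᶜʳ g z
... | h₁ , h₂ =
  _ , convᶜ (≈ᶜ-sym (≈ᶜ-trans ctx (≈ᶜ-trans (⊎ᶜ-cong h₂ ≈ᶜ-refl) (⊎ᶜ-assoc (tailᶜ Θ₁) (tailᶜ Θ₂) Δ))))
            (appT dt' (esT (convᶜ h₁ ds) du))

axR-≿ˢ : ∀ t s u → app t (es s u) ≾ˢ es (app (shift 1 t) s) u
axR-≿ˢ t s u d with app-inversion d
... | mkAppInv Γ₁ Δ₁ B _ _ dt d₁ ctx _ with es-inversion d₁
... | mkEsInv Θ₁ Θ₂ A _ _ ds du g _ =
  _ , convᶜ (≈ᶜ-sym (≈ᶜ-trans ctx (≈ᶜ-trans (⊎ᶜ-cong ≈ᶜ-refl g) (≈ᶜ-sym (⊎ᶜ-assoc Γ₁ Θ₁ Θ₂)))))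
            (esT (convᶜ (▸-⊎ᶜ Γ₁ Θ₁ [] A) (appT (shift1-typing dt) ds)) du)

push-skip1-▸ : ∀ Γ A → push skip1ᵉ (Γ ▸ A) ≈ᶜ ((Γ ▸ []) ▸ A)
push-skip1-▸ Γ A zero          = ≈ₘ-refl A
push-skip1-▸ Γ A (suc zero)    = []
push-skip1-▸ Γ A (suc (suc n)) = ≈ₘ-refl (Γ n)

pull-skip1-▸ : ∀ Γ A → pull skip1ᵉ (Γ ▸ A) ≈ᶜ (tailᶜ Γ ▸ A)
pull-skip1-▸ Γ A zero    = ≈ₘ-refl A
pull-skip1-▸ Γ A (suc n) = ≈ₘ-refl (Γ (suc n))

axEs-≾ˢ : ∀ t u s → es (es (rename skip1 t) u) s ≾ˢ es t (es u s)
axEs-≾ˢ t u s d with es-inversion d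
... | mkEsInv Γ₁ Δs B _ _ d₁ ds ctx _ with es-inversion d₁
... | mkEsInv Θ₁ Θ₂ A _ _ dt du g _ with rename-typing⁻¹ skip1ᵉ t dt
... | dt' , gt with ▸-split-⊎ᶜʳ g (gt (suc zero))
... | h₁ , h₂ =
  _ , convᶜ (≈ᶜ-sym (≈ᶜ-trans ctx (≈ᶜ-trans (⊎ᶜ-cong h₂ ≈ᶜ-refl) (⊎ᶜ-assoc (tailᶜ Θ₁) (tailᶜ Θ₂) Δs))))
            (esT (convᶜ (pull-skip1-▸ Θ₁ A) dt') (esT (convᶜ h₁ du) ds))

axEs-≿ˢ : ∀ t u s → es t (es u s) ≾ˢ es (es (rename skip1 t) u) s
axEs-≿ˢ t u s d with es-inversion d
... | mkEsInv Γ₁ Δ₁ A _ _ dt d₁ ctx _ with es-inversion d₁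
... | mkEsInv Θ₁ Θ₂ B _ _ du ds g _ =
  _ , convᶜ (≈ᶜ-sym (≈ᶜ-trans ctx (≈ᶜ-trans (⊎ᶜ-cong ≈ᶜ-refl g) (≈ᶜ-sym (⊎ᶜ-assoc Γ₁ Θ₁ Θ₂)))))
            (esT (convᶜ (▸-⊎ᶜ Γ₁ Θ₁ [] B) (esT (convᶜ (push-skip1-▸ Γ₁ A) (rename-typing skip1ᵉ dt)) du)) ds)

push-swap01-▸ : ∀ Γ A B → push swap01ᵉ ((Γ ▸ A) ▸ B) ≈ᶜ ((Γ ▸ B) ▸ A)
push-swap01-▸ Γ A B zero          = ≈ₘ-refl A
push-swap01-▸ Γ A B (suc zero)    = ≈ₘ-refl B
push-swap01-▸ Γ A B (suc (suc n)) = ≈ₘ-refl (Γ n)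

axCom-≾ˢ : ∀ t s u → es (es t (shift 1 s)) u ≾ˢ es (es (rename swap01 t) (shift 1 u)) s
axCom-≾ˢ t s u d with es-inversion d
... | mkEsInv Γ₁ Δu A _ _ d₁ du ctx _ with es-inversion d₁
... | mkEsInv Θ₁ Θ₂ B _ _ dt ds g _ with shift1-typing⁻¹ s ds
... | ds' , z with ▸-split-⊎ᶜˡ g z
... | h₁ , h₂ =
  _ , convᶜ (≈ᶜ-sym (≈ᶜ-trans ctx (≈ᶜ-trans (⊎ᶜ-cong h₂ ≈ᶜ-refl) (⊎ᶜ-swapʳ (tailᶜ Θ₁) (tailᶜ Θ₂) Δu))))
            (esT (convᶜ (▸-⊎ᶜ-[]ʳ (tailᶜ Θ₁) Δu B)
                        (esT (convᶜ (push-swap01-▸ (tailᶜ Θ₁) A B)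
                                    (rename-typing swap01ᵉ (convᶜ (▸-cong h₁ (≈ₘ-refl B)) dt)))
                             (shift1-typing du)))
                 ds')

-- axCom is its own converse up to renaming by the involution swap01
axCom-≿ˢ : ∀ t s u → es (es (rename swap01 t) (shift 1 u)) s ≾ˢ es (es t (shift 1 s)) u
axCom-≿ˢ t s u d with axCom-≾ˢ (rename swap01 t) u s d
... | _ , d' = _ , cast (≡.cong (λ z → es (es z (shift 1 s)) u) (rename-swap01-involutive t)) d'

lam-≾ˢ : ∀ {t t'} → t ≾ˢ t' → lam t ≾ˢ lam t'
lam-≾ˢ {t} {t'} f d with value-inversion (lam t) d
... | mkValueInv _ _ m g _ = _ , convᶜ (≈ᶜ-sym g) (proj₂ (Many-≾ˢ m))
  where
  Many-≾ˢ : ∀ {Θ N k} → Many Θ (lam t) N k → Θ ⊢ˢ lam t' ∶ N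
  Many-≾ˢ (mnil _) = 0 , manyNil (lam t')
  Many-≾ˢ (mcons (abs b) m) with f b | Many-≾ˢ m
  ... | _ , b' | _ , m' = _ , manyCons (abs b') m'

appˡ-≾ˢ : ∀ {t t'} u → t ≾ˢ t' → app t u ≾ˢ app t' u
appˡ-≾ˢ u f d with app-inversion d
... | mkAppInv _ _ _ _ _ dt du ctx _ with f dt
... | _ , dt' = _ , convᶜ (≈ᶜ-sym ctx) (appT dt' du)

appʳ-≾ˢ : ∀ t {u u'} → u ≾ˢ u' → app t u ≾ˢ app t u'
appʳ-≾ˢ t f d with app-inversion d
... | mkAppInv _ _ _ _ _ dt du ctx _ with f du
... | _ , du' = _ , convᶜ (≈ᶜ-sym ctx) (appT dt du')

esˡ-≾ˢ : ∀ {t t'} u → t ≾ˢ t' → es t u ≾ˢ es t' u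
esˡ-≾ˢ u f d with es-inversion d
... | mkEsInv _ _ _ _ _ dt du ctx _ with f dt
... | _ , dt' = _ , convᶜ (≈ᶜ-sym ctx) (esT dt' du)

esʳ-≾ˢ : ∀ t {u u'} → u ≾ˢ u' → es t u ≾ˢ es t u'
esʳ-≾ˢ t f d with es-inversion d
... | mkEsInv _ _ _ _ _ dt du ctx _ with f du
... | _ , du' = _ , convᶜ (≈ᶜ-sym ctx) (esT dt du')

≡str⇒≾ˢ : ∀ {t t'} → t ≡str t' → (t ≾ˢ t') × (t' ≾ˢ t)
≡str⇒≾ˢ (axL t s u)   = axL-≾ˢ t s u , axL-≿ˢ t s u
≡str⇒≾ˢ (axR t s u)   = axR-≾ˢ t s u , axR-≿ˢ t s u
≡str⇒≾ˢ (axEs t u s)  = axEs-≾ˢ t u s , axEs-≿ˢ t u s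
≡str⇒≾ˢ (axCom t s u) = axCom-≾ˢ t s u , axCom-≿ˢ t s u
≡str⇒≾ˢ (refl t)      = (λ d → _ , d) , (λ d → _ , d)
≡str⇒≾ˢ (sym p)       = proj₂ (≡str⇒≾ˢ p) , proj₁ (≡str⇒≾ˢ p)
≡str⇒≾ˢ (trans p q)   = ≾ˢ-trans (proj₁ (≡str⇒≾ˢ p)) (proj₁ (≡str⇒≾ˢ q)) ,
                        ≾ˢ-trans (proj₂ (≡str⇒≾ˢ q)) (proj₂ (≡str⇒≾ˢ p))
≡str⇒≾ˢ (appL u p)    = appˡ-≾ˢ u (proj₁ (≡str⇒≾ˢ p)) , appˡ-≾ˢ u (proj₂ (≡str⇒≾ˢ p))
≡str⇒≾ˢ (appR t p)    = appʳ-≾ˢ t (proj₁ (≡str⇒≾ˢ p)) , appʳ-≾ˢ t (proj₂ (≡str⇒≾ˢ p))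
≡str⇒≾ˢ (lam p)       = lam-≾ˢ (proj₁ (≡str⇒≾ˢ p)) , lam-≾ˢ (proj₂ (≡str⇒≾ˢ p))
≡str⇒≾ˢ (esL u p)     = esˡ-≾ˢ u (proj₁ (≡str⇒≾ˢ p)) , esˡ-≾ˢ u (proj₂ (≡str⇒≾ˢ p))
≡str⇒≾ˢ (esR t p)     = esʳ-≾ˢ t (proj₁ (≡str⇒≾ˢ p)) , esʳ-≾ˢ t (proj₂ (≡str⇒≾ˢ p))

module _ (R : Term → Term → Set) (sim : NetSimulation R) where

  -- Evaluation does not increase the size bound, and the components of the
  -- normal form are typed by strict subderivations.
  R⇒⊢ˢ : ∀ n {t t' Γ M k} → k < n → R t t' → Γ ⊢[ k ] t ∶ M → Γ ⊢ˢ t' ∶ M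
  R⇒⊢ˢ (suc n) lt r d with sim r
  ... | diverge ¬nf = ⊥-elim (¬nf (typable⇒HasNF d))
  ... | var x (_ , t⇓) (_ , t'⇓) = ⇓-reflects-typing t'⇓ (⇓-preserves-typing t⇓ d)
  ... | lam t₁ t₁' (_ , t⇓) (_ , t'⇓) r₁ with value-inversion (lam t₁) (⇓-preserves-typing t⇓ d)
  ...   | mkValueInv _ _ m g le = ⇓-reflects-typing t'⇓ (convᶜ (≈ᶜ-sym g) (proj₂ (Many-R m (≤-trans le (≤-pred lt)))))
    where
    Many-R : ∀ {Θ N k} → Many Θ (lam t₁) N k → k ≤ n → Θ ⊢ˢ lam t₁' ∶ N
    Many-R (mnil _) _ = 0 , manyNil (lam t₁')
    Many-R (mcons (abs b) m) le with R⇒⊢ˢ n (≤-trans (m≤m+n _ _) le) r₁ b | Many-R m (≤-trans (m≤n+m _ _) le)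
    ... | _ , b' | _ , m' = _ , manyCons (abs b') m'
  R⇒⊢ˢ (suc n) lt r d | app n₁ n₂ n' n₁' n₂' (_ , t⇓) (_ , t'⇓) n'≡ r₁ r₂
    with app-inversion (⇓-preserves-typing t⇓ d)
  ... | mkAppInv _ _ _ _ _ d₁ d₂ ctx sz
    with R⇒⊢ˢ n (≤-trans (s≤s (m≤m+n _ _)) (≤-trans sz (≤-pred lt))) r₁ d₁
       | R⇒⊢ˢ n (≤-trans (s≤s (m≤n+m _ _)) (≤-trans sz (≤-pred lt))) r₂ d₂
  ... | _ , d₁' | _ , d₂' =
    ⇓-reflects-typing t'⇓ (proj₂ (proj₂ (≡str⇒≾ˢ n'≡) (convᶜ (≈ᶜ-sym ctx) (appT d₁' d₂'))))
  R⇒⊢ˢ (suc n) lt r d | es n₁ n₂ n' n₁' n₂' (_ , t⇓) (_ , t'⇓) n'≡ r₁ r₂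
    with es-inversion (⇓-preserves-typing t⇓ d)
  ... | mkEsInv _ _ _ _ _ d₁ d₂ ctx sz
    with R⇒⊢ˢ n (≤-trans (s≤s (m≤m+n _ _)) (≤-trans sz (≤-pred lt))) r₁ d₁
       | R⇒⊢ˢ n (≤-trans (s≤s (m≤n+m _ _)) (≤-trans sz (≤-pred lt))) r₂ d₂
  ... | _ , d₁' | _ , d₂' =
    ⇓-reflects-typing t'⇓ (proj₂ (proj₂ (≡str⇒≾ˢ n'≡) (convᶜ (≈ᶜ-sym ctx) (esT d₁' d₂'))))

  net-simulation⇒≾type : ∀ t t' → R t t' → t ≾type t'
  net-simulation⇒≾type t t' r Γ M d with sized d
  ... | k , d' = unsized (proj₂ (R⇒⊢ˢ (suc k) ≤-refl r d'))

proposition12p5 :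
    ((R : Term → Term → Set) → NetSimulation R →
      ∀ t t' → R t t' → ∀ Γ M → Γ ⊢ t ∶ M → Γ ⊢ t' ∶ M)
    × (∀ t t' → t ≾net t' → t ≾type t')
proposition12p5 = net-simulation⇒≾type , λ { t t' (R , sim , r) → net-simulation⇒≾type R sim t t' r }
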